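{- Let $G=(V,E)$ be a connected graph of order $n$ and diameter $d \geq 3$ such that every spanning tree $T$ of $G$ is a caterpillar of diameter $d$. Then $\xi^{c}(G) \geq \xi^{c}(V_{n,d})$.
   Context: All graphs are finite, simple and connected. For a vertex $v$, $\epsilon(v)=\max_{u} d(u,v)$ is its eccentricity ($d(u,v)$ the shortest-path distance) and ${\rm d}(v)$ its degree. The eccentric connectivity index is $\xi^{c}(G) = \sum_{v \in V(G)} \epsilon(v)\,{\rm d}(v)$. A caterpillar is a tree in which every vertex is within distance one of a central path. The volcano graph $V_{n,d}$ is obtained from a path $P_{d+1}$ and a set $S$ of $n-d-1$ further vertices by joining each vertex of $S$ to a central vertex of $P_{d+1}$ (the unique middle vertex if $d$ is even, one of the two middle vertices if $d$ is odd); its eccentric connectivity index does not depend on these choices and equals $nd+n+\frac{d^{2}}{2}-2d-1$ for $d$ even and $nd+2n+\frac{d^{2}}{2}-3d-\frac{3}{2}$ for $d$ odd. -}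

module Defs where

open import Data.Nat using (ℕ; zero; suc; _+_; _*_; _⊔_; _≤_; _<ᵇ_; _≡ᵇ_; _≤ᵇ_; ⌊_/2⌋)
open import Data.Bool using (Bool; true; false; _∧_; _∨_; not; if_then_else_)
open import Data.Fin using (Fin; toℕ; _≟_)
open import Data.List using (List; []; _∷_; map; foldr; allFin; length; _∷ʳ_)
open import Data.Bool.ListAction using (any)
open import Data.Nat.ListAction using (sum)
open import Data.List.Relation.Unary.Any using (Any)
open import Data.List.Relation.Unary.Linked using (Linked)
open import Data.List.Relation.Unary.Unique.Propositional using (Unique)
open import Data.Product using (Σ; _×_)
open import Data.Sum using (_⊎_)
open import Relation.Nullary using (¬_; does)
open import Relation.Binary.PropositionalEquality using (_≡_)

-- It is given by an arbitrary
-- Boolean relation `rel`; the adjacency is its symmetric, loop-free closure,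
-- so every graph is simple and every simple graph arises this way.
record Graph (n : ℕ) : Set where
  field
    rel : Fin n → Fin n → Bool

module _ {n : ℕ} (G : Graph n) where
  open Graph G

  adj : Fin n → Fin n → Bool
  adj u v = (rel u v ∨ rel v u) ∧ not (does (u ≟ v))

  Adj : Fin n → Fin n → Set
  Adj u v = adj u v ≡ true

  reach : ℕ → Fin n → Fin n → Bool
  reach zero    u v = does (u ≟ v)
  reach (suc k) u v = reach k u v ∨ any (λ w → adj u w ∧ reach k w v) (allFin n)

  Connected : Set
  Connected = ∀ u v → reach n u v ≡ true

  -- shortest-path distance: least k with a walk of length ≤ k
  -- (a simple path has length < n; if unreachable the value n is returned,
  -- which never happens for connected graphs)
  distFrom : ℕ → ℕ → Fin n → Fin n → ℕ
  distFrom k zero    u v = k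
  distFrom k (suc f) u v = if reach k u v then k else distFrom (suc k) f u v

  dist : Fin n → Fin n → ℕ
  dist u v = distFrom 0 n u v

  maxOver : (Fin n → ℕ) → ℕ
  maxOver f = foldr _⊔_ 0 (map f (allFin n))

  sumOver : (Fin n → ℕ) → ℕ
  sumOver f = sum (map f (allFin n))

  ecc : Fin n → ℕ
  ecc v = maxOver (λ u → dist u v)

  degree : Fin n → ℕ
  degree v = sumOver (λ u → if adj v u then 1 else 0)

  diameter : ℕ
  diameter = maxOver ecc

  ξc : ℕ
  ξc = sumOver (λ v → ecc v * degree v)

  HasCycle : Set
  HasCycle = Σ (Fin n) λ u → Σ (List (Fin n)) λ rest →
    (2 ≤ length rest) × Unique (u ∷ rest) × Linked Adj (u ∷ (rest ∷ʳ u))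

  IsTree : Set
  IsTree = Connected × ¬ HasCycle

  IsPath : List (Fin n) → Set
  IsPath P = Unique P × Linked Adj P

  IsCaterpillar : Set
  IsCaterpillar = IsTree × Σ (List (Fin n)) λ P → IsPath P ×
    (∀ v → Any (λ p → p ≡ v ⊎ Adj p v) P)

IsSpanningTree : {n : ℕ} → Graph n → Graph n → Set
IsSpanningTree G T = (∀ u v → Adj T u v → Adj G u v) × IsTree T

-- Volcano graph V_{n,d}: path 0 – 1 – … – d, and every vertex i > d joined
-- to the central vertex ⌊d/2⌋ of the path.
volcano : (n d : ℕ) → Graph n
volcano n d = record { rel = λ i j → vrel (toℕ i) (toℕ j) }
  where
  vrel : ℕ → ℕ → Bool
  vrel i j = ((suc i ≡ᵇ j) ∧ (j ≤ᵇ d)) ∨ ((d <ᵇ i) ∧ (j ≡ᵇ ⌊ d /2⌋))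

-- Fix a, b with dist a b = d.  Double counting gives 2 ξc(G) = Σ over ordered adjacent pairs (u, v) of
-- ecc u + ecc v, and each edge can be credited to its endpoints according to the distance to a, and again
-- according to the distance to b.  A vertex on an a–b geodesic at distance i from a then collects at least
-- R i (its edges towards a and towards b), any other vertex at least K = 2 (2⌈d/2⌉ + 1), and every layer
-- i ≤ d contains a geodesic vertex, so 2 ξc(G) + (d + 1) K ≥ n K + Σ R.  In V_{n,d} the path vertices
-- collect exactly R and the pendant vertices exactly K, so 2 ξc(V_{n,d}) + (d + 1) K ≤ n K + Σ R.

module Submission where

open import Defs
open import Data.Nat using (ℕ; zero; suc; pred; >-nonZero; _+_; _*_; _∸_; _⊔_; _≤_; _<_; z≤n; s≤s; s≤s⁻¹; _≡ᵇ_; _≤ᵇ_; _<ᵇ_; ⌊_/2⌋; ⌈_/2⌉; ∣_-_∣)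
open import Data.Nat.Properties hiding (_≟_)
open import Data.Nat.Properties using () renaming (_≟_ to _≟ℕ_)
open import Data.Nat.Solver using (module +-*-Solver)
open import Data.Bool using (Bool; true; false; T; _∧_; _∨_; not; if_then_else_)
open import Data.Bool.Properties using (∨-comm)
open import Data.Fin using (Fin; toℕ; _≟_; fromℕ<) renaming (zero to fz; suc to fs)
open import Data.Fin.Properties using (toℕ-fromℕ<; toℕ-injective; toℕ<n) renaming (suc-injective to fs-injective)
open import Data.List using (foldr; tabulate)
open import Data.List.Properties using (map-tabulate)
open import Data.Nat.ListAction using (sum)
open import Data.Bool.ListAction using (any)
open import Data.Product using (Σ; _×_; _,_; proj₁; proj₂)
open import Data.Sum using (_⊎_; inj₁; inj₂)
open import Data.Empty using (⊥-elim)
open import Relation.Nullary using (does; yes; no)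
open import Relation.Binary.PropositionalEquality
open import Relation.Binary.Definitions using (tri<; tri≈; tri>)
open import Algebra.Properties.CommutativeSemigroup +-commutativeSemigroup using (interchange)

open +-*-Solver

∑ : ∀ {n} → (Fin n → ℕ) → ℕ
∑ f = sum (tabulate f)

sumOver-∑ : ∀ {n} (G : Graph n) (f : Fin n → ℕ) → sumOver G f ≡ ∑ f
sumOver-∑ G f = cong sum (map-tabulate (λ x → x) f)

∑-cong : ∀ {n} {f g : Fin n → ℕ} → (∀ i → f i ≡ g i) → ∑ f ≡ ∑ g
∑-cong {zero}  f≡g = refl
∑-cong {suc n} f≡g = cong₂ _+_ (f≡g fz) (∑-cong (λ i → f≡g (fs i)))

∑-mono-≤ : ∀ {n} {f g : Fin n → ℕ} → (∀ i → f i ≤ g i) → ∑ f ≤ ∑ g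
∑-mono-≤ {zero}  f≤g = z≤n
∑-mono-≤ {suc n} f≤g = +-mono-≤ (f≤g fz) (∑-mono-≤ (λ i → f≤g (fs i)))

∑-zero : ∀ {n} → ∑ {n} (λ _ → 0) ≡ 0
∑-zero {zero}  = refl
∑-zero {suc n} = ∑-zero {n}

∑-const : ∀ {n} (k : ℕ) → ∑ {n} (λ _ → k) ≡ n * k
∑-const {zero}  k = refl
∑-const {suc n} k = cong (k +_) (∑-const {n} k)

∑-distrib-+ : ∀ {n} (f g : Fin n → ℕ) → ∑ (λ i → f i + g i) ≡ ∑ f + ∑ g
∑-distrib-+ {zero}  f g = refl
∑-distrib-+ {suc n} f g
  rewrite ∑-distrib-+ (λ i → f (fs i)) (λ i → g (fs i)) = interchange (f fz) (g fz) _ _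

∑-*ˡ : ∀ {n} (k : ℕ) (f : Fin n → ℕ) → ∑ (λ i → k * f i) ≡ k * ∑ f
∑-*ˡ {zero}  k f = sym (*-zeroʳ k)
∑-*ˡ {suc n} k f rewrite ∑-*ˡ k (λ i → f (fs i)) = sym (*-distribˡ-+ k (f fz) _)

∑-comm : ∀ {n m} (f : Fin n → Fin m → ℕ) → ∑ (λ i → ∑ (f i)) ≡ ∑ (λ j → ∑ (λ i → f i j))
∑-comm {zero}  {m} f = sym (∑-zero {m})
∑-comm {suc n} f = trans (cong (∑ (f fz) +_) (∑-comm (λ i → f (fs i))))
                         (sym (∑-distrib-+ (f fz) (λ j → ∑ (λ i → f (fs i) j))))

term≤∑ : ∀ {n} (f : Fin n → ℕ) (x : Fin n) → f x ≤ ∑ f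
term≤∑ f fz     = m≤m+n _ _
term≤∑ f (fs x) = ≤-trans (term≤∑ (λ i → f (fs i)) x) (m≤n+m _ _)

terms≤∑ : ∀ {n} (f : Fin n → ℕ) (x y : Fin n) → x ≢ y → f x + f y ≤ ∑ f
terms≤∑ f fz     fz     x≢y = ⊥-elim (x≢y refl)
terms≤∑ f fz     (fs y) x≢y = +-monoʳ-≤ (f fz) (term≤∑ (λ i → f (fs i)) y)
terms≤∑ f (fs x) fz     x≢y =
  subst (_≤ ∑ f) (+-comm (f fz) (f (fs x))) (+-monoʳ-≤ (f fz) (term≤∑ (λ i → f (fs i)) x))
terms≤∑ f (fs x) (fs y) x≢y =
  ≤-trans (terms≤∑ (λ i → f (fs i)) x y (λ x≡y → x≢y (cong fs x≡y))) (m≤n+m _ _)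

∑-single : ∀ {n} (f : Fin n → ℕ) (x : Fin n) → (∀ y → y ≢ x → f y ≡ 0) → ∑ f ≡ f x
∑-single {suc n} f fz vanish =
  trans (cong (f fz +_) (trans (∑-cong (λ i → vanish (fs i) (λ ()))) (∑-zero {n}))) (+-identityʳ _)
∑-single {suc n} f (fs x) vanish =
  trans (cong (_+ ∑ (λ i → f (fs i))) (vanish fz (λ ())))
        (∑-single (λ i → f (fs i)) x (λ y y≢x → vanish (fs y) (λ e → y≢x (fs-injective e))))

∑ℕ : ℕ → (ℕ → ℕ) → ℕ
∑ℕ zero    f = 0
∑ℕ (suc k) f = f 0 + ∑ℕ k (λ i → f (suc i))

∑-toℕ : ∀ {n} (f : ℕ → ℕ) → ∑ {n} (λ i → f (toℕ i)) ≡ ∑ℕ n f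
∑-toℕ {zero}  f = refl
∑-toℕ {suc n} f = cong (f 0 +_) (∑-toℕ {n} (λ i → f (suc i)))

∑ℕ-cong : ∀ k {f g : ℕ → ℕ} → (∀ i → i < k → f i ≡ g i) → ∑ℕ k f ≡ ∑ℕ k g
∑ℕ-cong zero    f≡g = refl
∑ℕ-cong (suc k) f≡g = cong₂ _+_ (f≡g 0 (s≤s z≤n)) (∑ℕ-cong k (λ i i<k → f≡g (suc i) (s≤s i<k)))

∑ℕ-mono-≤ : ∀ k {f g : ℕ → ℕ} → (∀ i → i < k → f i ≤ g i) → ∑ℕ k f ≤ ∑ℕ k g
∑ℕ-mono-≤ zero    f≤g = z≤n
∑ℕ-mono-≤ (suc k) f≤g = +-mono-≤ (f≤g 0 (s≤s z≤n)) (∑ℕ-mono-≤ k (λ i i<k → f≤g (suc i) (s≤s i<k)))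

∑ℕ-zero : ∀ k → ∑ℕ k (λ _ → 0) ≡ 0
∑ℕ-zero zero    = refl
∑ℕ-zero (suc k) = ∑ℕ-zero k

∑ℕ-const : ∀ k c → ∑ℕ k (λ _ → c) ≡ k * c
∑ℕ-const zero    c = refl
∑ℕ-const (suc k) c = cong (c +_) (∑ℕ-const k c)

∑ℕ-distrib-+ : ∀ k (f g : ℕ → ℕ) → ∑ℕ k (λ i → f i + g i) ≡ ∑ℕ k f + ∑ℕ k g
∑ℕ-distrib-+ zero    f g = refl
∑ℕ-distrib-+ (suc k) f g
  rewrite ∑ℕ-distrib-+ k (λ i → f (suc i)) (λ i → g (suc i)) = interchange (f 0) (g 0) _ _

∑ℕ-*ˡ : ∀ k c (f : ℕ → ℕ) → ∑ℕ k (λ i → c * f i) ≡ c * ∑ℕ k f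
∑ℕ-*ˡ zero    c f = sym (*-zeroʳ c)
∑ℕ-*ˡ (suc k) c f = trans (cong (c * f 0 +_) (∑ℕ-*ˡ k c (λ i → f (suc i)))) (sym (*-distribˡ-+ c (f 0) _))

∑ℕ-split : ∀ a b (f : ℕ → ℕ) → ∑ℕ (a + b) f ≡ ∑ℕ a f + ∑ℕ b (λ i → f (a + i))
∑ℕ-split zero    b f = refl
∑ℕ-split (suc a) b f rewrite ∑ℕ-split a b (λ i → f (suc i)) = sym (+-assoc (f 0) _ _)

∑-∑ℕ-comm : ∀ {n} k (f : Fin n → ℕ → ℕ) → ∑ (λ u → ∑ℕ k (f u)) ≡ ∑ℕ k (λ i → ∑ (λ u → f u i))
∑-∑ℕ-comm {n} zero    f = ∑-zero {n}
∑-∑ℕ-comm     (suc k) f = trans (∑-distrib-+ (λ u → f u 0) (λ u → ∑ℕ k (λ i → f u (suc i))))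
                                (cong (∑ (λ u → f u 0) +_) (∑-∑ℕ-comm k (λ u i → f u (suc i))))

if≡ᵇ-≡ : ∀ {i j} {A : Set} {t f : A} → i ≡ j → (if i ≡ᵇ j then t else f) ≡ t
if≡ᵇ-≡ {zero}  refl = refl
if≡ᵇ-≡ {suc i} refl = if≡ᵇ-≡ {i} refl

if≡ᵇ-≢ : ∀ {i j} {A : Set} {t f : A} → i ≢ j → (if i ≡ᵇ j then t else f) ≡ f
if≡ᵇ-≢ {zero}  {zero}  i≢j = ⊥-elim (i≢j refl)
if≡ᵇ-≢ {zero}  {suc j} i≢j = refl
if≡ᵇ-≢ {suc i} {zero}  i≢j = refl
if≡ᵇ-≢ {suc i} {suc j} i≢j = if≡ᵇ-≢ {i} {j} (λ i≡j → i≢j (cong suc i≡j))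

δ : ℕ → ℕ → ℕ → ℕ
δ i j x = if i ≡ᵇ j then x else 0

δ-≡ : ∀ {i j} x → i ≡ j → δ i j x ≡ x
δ-≡ x = if≡ᵇ-≡

δ-≢ : ∀ {i j} x → i ≢ j → δ i j x ≡ 0
δ-≢ x = if≡ᵇ-≢

δ-≤ : ∀ i j x → δ i j x ≤ x
δ-≤ i j x with i ≡ᵇ j
... | true  = ≤-refl
... | false = z≤n

δ-mono-≤ : ∀ i j {x y} → x ≤ y → δ i j x ≤ δ i j y
δ-mono-≤ i j x≤y with i ≡ᵇ j
... | true  = x≤y
... | false = z≤n

δ-zero : ∀ i j → δ i j 0 ≡ 0
δ-zero i j with i ≡ᵇ j
... | true  = refl
... | false = refl

δ-sym : ∀ i j x → δ i j x ≡ δ j i x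
δ-sym i j x with i ≟ℕ j
... | yes refl = refl
... | no  i≢j  = trans (δ-≢ x i≢j) (sym (δ-≢ x (≢-sym i≢j)))

δ-*ʳ : ∀ i j x y → δ i j x * y ≡ δ i j (x * y)
δ-*ʳ i j x y with i ≡ᵇ j
... | true  = refl
... | false = refl

δ-cong-⇔ : ∀ {i j i′ j′} x → (i ≡ j → i′ ≡ j′) → (i′ ≡ j′ → i ≡ j) → δ i j x ≡ δ i′ j′ x
δ-cong-⇔ {i} {j} x to from with i ≟ℕ j
... | yes i≡j = trans (δ-≡ x i≡j) (sym (δ-≡ x (to i≡j)))
... | no  i≢j = trans (δ-≢ x i≢j) (sym (δ-≢ x (λ e → i≢j (from e))))

∑ℕ-δ≤ : ∀ k j (g : ℕ → ℕ) → ∑ℕ k (λ i → δ j i (g i)) ≤ g j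
∑ℕ-δ≤ zero    j       g = z≤n
∑ℕ-δ≤ (suc k) zero    g = ≤-reflexive (trans (cong (g 0 +_) (∑ℕ-zero k)) (+-identityʳ _))
∑ℕ-δ≤ (suc k) (suc j) g = ∑ℕ-δ≤ k j (λ i → g (suc i))

∑ℕ-δ≤′ : ∀ k j (g : ℕ → ℕ) → ∑ℕ k (λ i → δ i j (g i)) ≤ g j
∑ℕ-δ≤′ k j g = ≤-trans (≤-reflexive (∑ℕ-cong k (λ i _ → δ-sym i j (g i)))) (∑ℕ-δ≤ k j g)

∑ℕ-δ-pred≤ : ∀ k j x → ∑ℕ k (λ i → δ (suc i) j x) ≤ x
∑ℕ-δ-pred≤ k zero    x = ≤-trans (≤-reflexive (∑ℕ-zero k)) z≤n
∑ℕ-δ-pred≤ k (suc j) x = ∑ℕ-δ≤′ k j (λ _ → x)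

∑ℕ-δ-outside : ∀ k i j (f : ℕ → ℕ) → ∑ℕ k (λ l → δ i j (f l)) ≡ δ i j (∑ℕ k f)
∑ℕ-δ-outside k i j f with i ≡ᵇ j
... | true  = refl
... | false = ∑ℕ-zero k

∑ℕ-δ : ∀ k j (g : ℕ → ℕ) → j < k → ∑ℕ k (λ i → δ j i (g i)) ≡ g j
∑ℕ-δ (suc k) zero    g j<k       = trans (cong (g 0 +_) (∑ℕ-zero k)) (+-identityʳ _)
∑ℕ-δ (suc k) (suc j) g (s≤s j<k) = ∑ℕ-δ k j (λ i → g (suc i)) j<k

∑ℕ-δ′ : ∀ k j (g : ℕ → ℕ) → j < k → ∑ℕ k (λ i → δ i j (g i)) ≡ g j
∑ℕ-δ′ k j g j<k = trans (∑ℕ-cong k (λ i _ → δ-sym i j (g i))) (∑ℕ-δ k j g j<k)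

δ-adjacent : ∀ {x y} e → x ≤ suc y → y ≤ suc x → δ (suc y) x e + δ y x e + δ (suc x) y e ≡ e
δ-adjacent {x} {y} e x≤1+y y≤1+x with <-cmp x y
... | tri< x<y _ _ rewrite δ-≢ e (λ 1+y≡x → <⇒≱ x<y (≤-trans (n≤1+n y) (≤-reflexive 1+y≡x)))
                         | δ-≢ e (≢-sym (<⇒≢ x<y)) = δ-≡ e (≤-antisym x<y y≤1+x)
... | tri≈ _ refl _ rewrite δ-≢ e (1+n≢n {x}) | δ-≡ {x} e refl = +-identityʳ e
... | tri> _ _ y<x rewrite δ-≢ e (λ 1+x≡y → <⇒≱ y<x (≤-trans (n≤1+n x) (≤-reflexive 1+x≡y)))
                         | δ-≢ e (<⇒≢ y<x) = trans (+-identityʳ _) (trans (+-identityʳ _) (δ-≡ e (≤-antisym y<x x≤1+y)))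

∨-introˡ : ∀ {a} b → a ≡ true → a ∨ b ≡ true
∨-introˡ b refl = refl

∨-introʳ : ∀ a {b} → b ≡ true → a ∨ b ≡ true
∨-introʳ true  refl = refl
∨-introʳ false refl = refl

∨-elim : ∀ a {b} → a ∨ b ≡ true → a ≡ true ⊎ b ≡ true
∨-elim true  _  = inj₁ refl
∨-elim false e = inj₂ e

∧-intro : ∀ {a b} → a ≡ true → b ≡ true → a ∧ b ≡ true
∧-intro refl refl = refl

∧-elim : ∀ a {b} → a ∧ b ≡ true → a ≡ true × b ≡ true
∧-elim true e = refl , e

any-tabulate⁺ : ∀ {A : Set} {n} (g : Fin n → A) (f : A → Bool) w → f (g w) ≡ true → any f (tabulate g) ≡ true
any-tabulate⁺ g f fz     e = ∨-introˡ _ e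
any-tabulate⁺ g f (fs w) e = ∨-introʳ (f (g fz)) (any-tabulate⁺ (λ i → g (fs i)) f w e)

any-tabulate⁻ : ∀ {A : Set} {n} (g : Fin n → A) (f : A → Bool) → any f (tabulate g) ≡ true →
                Σ (Fin n) λ w → f (g w) ≡ true
any-tabulate⁻ {n = suc n} g f e with ∨-elim (f (g fz)) e
... | inj₁ here  = fz , here
... | inj₂ there with any-tabulate⁻ (λ i → g (fs i)) f there
...   | w , fw = fs w , fw

≟-refl : ∀ {n} (u : Fin n) → does (u ≟ u) ≡ true
≟-refl u with u ≟ u
... | yes _   = refl
... | no  u≢u = ⊥-elim (u≢u refl)

≟-sym : ∀ {n} (u v : Fin n) → does (u ≟ v) ≡ does (v ≟ u)
≟-sym u v with u ≟ v | v ≟ u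
... | yes _   | yes _   = refl
... | no  _   | no  _   = refl
... | yes u≡v | no  v≢u = ⊥-elim (v≢u (sym u≡v))
... | no  u≢v | yes v≡u = ⊥-elim (u≢v (sym v≡u))

module _ {n : ℕ} (G : Graph n) where
  open Graph G

  adj-sym : ∀ u v → adj G u v ≡ adj G v u
  adj-sym u v rewrite ∨-comm (rel u v) (rel v u) | ≟-sym u v = refl

  Adj-sym : ∀ {u v} → Adj G u v → Adj G v u
  Adj-sym {u} {v} uv = trans (adj-sym v u) uv

  reach-refl : ∀ k u → reach G k u u ≡ true
  reach-refl zero    u = ≟-refl u
  reach-refl (suc k) u = ∨-introˡ _ (reach-refl k u)

  reach-suc : ∀ k u v → reach G k u v ≡ true → reach G (suc k) u v ≡ true
  reach-suc k u v r = ∨-introˡ _ r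

  reach-step : ∀ k u w v → Adj G u w → reach G k w v ≡ true → reach G (suc k) u v ≡ true
  reach-step k u w v uw r = ∨-introʳ (reach G k u v)
    (any-tabulate⁺ (λ x → x) (λ x → adj G u x ∧ reach G k x v) w (∧-intro uw r))

  reach-suc⁻ : ∀ k u v → reach G (suc k) u v ≡ true →
               reach G k u v ≡ true ⊎ Σ (Fin n) λ w → Adj G u w × reach G k w v ≡ true
  reach-suc⁻ k u v r with ∨-elim (reach G k u v) r
  ... | inj₁ r′ = inj₁ r′
  ... | inj₂ r′ with any-tabulate⁻ (λ x → x) (λ x → adj G u x ∧ reach G k x v) r′
  ...   | w , uw = inj₂ (w , ∧-elim (adj G u w) uw)

  reach-zero⁻ : ∀ u v → reach G 0 u v ≡ true → u ≡ v
  reach-zero⁻ u v r with u ≟ v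
  ... | yes u≡v = u≡v
  reach-zero⁻ u v () | no _

  reach-trans : ∀ k l u v w → reach G k u v ≡ true → reach G l v w ≡ true → reach G (k + l) u w ≡ true
  reach-trans zero    l u v w r s = subst (λ z → reach G l z w ≡ true) (sym (reach-zero⁻ u v r)) s
  reach-trans (suc k) l u v w r s with reach-suc⁻ k u v r
  ... | inj₁ r′            = reach-suc (k + l) u w (reach-trans k l u v w r′ s)
  ... | inj₂ (x , ux , r′) = reach-step (k + l) u x w ux (reach-trans k l x v w r′ s)

  reach-sym : ∀ k u v → reach G k u v ≡ true → reach G k v u ≡ true
  reach-sym zero    u v r = subst (λ z → reach G 0 v z ≡ true) (sym (reach-zero⁻ u v r)) (reach-refl 0 v)
  reach-sym (suc k) u v r with reach-suc⁻ k u v r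
  ... | inj₁ r′            = reach-suc k v u (reach-sym k u v r′)
  ... | inj₂ (x , ux , r′) = subst (λ z → reach G z v u ≡ true) (+-comm k 1)
          (reach-trans k 1 v x u (reach-sym k x v r′) (reach-step 0 x u u (Adj-sym ux) (reach-refl 0 u)))

  distFrom-minimal : ∀ f k j u v → k ≤ j → reach G j u v ≡ true → distFrom G k f u v ≤ j
  distFrom-minimal zero    k j u v k≤j r = k≤j
  distFrom-minimal (suc f) k j u v k≤j r with reach G k u v in eq
  ... | true  = k≤j
  ... | false = distFrom-minimal f (suc k) j u v (≤∧≢⇒< k≤j k≢j) r
    where
    k≢j : k ≢ j
    k≢j refl with trans (sym eq) r
    ... | ()

  distFrom-reach : ∀ f k u v → reach G (k + f) u v ≡ true → reach G (distFrom G k f u v) u v ≡ true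
  distFrom-reach zero    k u v r rewrite +-identityʳ k = r
  distFrom-reach (suc f) k u v r with reach G k u v in eq
  ... | true  = eq
  ... | false = distFrom-reach f (suc k) u v (subst (λ z → reach G z u v ≡ true) (+-suc k f) r)

  dist-minimal : ∀ j u v → reach G j u v ≡ true → dist G u v ≤ j
  dist-minimal j u v r = distFrom-minimal n 0 j u v z≤n r

  dist-self : ∀ u → dist G u u ≡ 0
  dist-self u = n≤0⇒n≡0 (dist-minimal 0 u u (reach-refl 0 u))

module Metric {n : ℕ} (G : Graph n) (conn : Connected G) where

  dist-reach : ∀ u v → reach G (dist G u v) u v ≡ true
  dist-reach u v = distFrom-reach G n 0 u v (conn u v)

  dist-sym : ∀ u v → dist G u v ≡ dist G v u
  dist-sym u v = ≤-antisym (flip u v) (flip v u)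
    where
    flip : ∀ u v → dist G u v ≤ dist G v u
    flip u v = dist-minimal G (dist G v u) u v (reach-sym G (dist G v u) v u (dist-reach v u))

  dist-triangle : ∀ u v w → dist G u w ≤ dist G u v + dist G v w
  dist-triangle u v w = dist-minimal G _ u w (reach-trans G (dist G u v) (dist G v w) u v w (dist-reach u v) (dist-reach v w))

  dist-adj : ∀ u w v → Adj G u w → dist G u v ≤ suc (dist G w v)
  dist-adj u w v uw = dist-minimal G _ u v (reach-step G (dist G w v) u w v uw (dist-reach w v))

  dist-zero⁻ : ∀ u v → dist G u v ≡ 0 → u ≡ v
  dist-zero⁻ u v e = reach-zero⁻ G u v (subst (λ z → reach G z u v ≡ true) e (dist-reach u v))

  dist-suc⁻ : ∀ u v k → dist G u v ≡ suc k → Σ (Fin n) λ w → Adj G u w × dist G w v ≡ k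
  dist-suc⁻ u v k e with reach-suc⁻ G k u v (subst (λ z → reach G z u v ≡ true) e (dist-reach u v))
  ... | inj₁ r = ⊥-elim (<⇒≱ (≤-reflexive (sym e)) (dist-minimal G k u v r))
  ... | inj₂ (w , uw , r) =
    w , uw , ≤-antisym (dist-minimal G k w v r) (s≤s⁻¹ (≤-trans (≤-reflexive (sym e)) (dist-adj u w v uw)))

⨆ : ∀ {n} → (Fin n → ℕ) → ℕ
⨆ f = foldr _⊔_ 0 (tabulate f)

maxOver-⨆ : ∀ {n} (G : Graph n) (f : Fin n → ℕ) → maxOver G f ≡ ⨆ f
maxOver-⨆ G f = cong (foldr _⊔_ 0) (map-tabulate (λ x → x) f)

term≤⨆ : ∀ {n} (f : Fin n → ℕ) x → f x ≤ ⨆ f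
term≤⨆ f fz     = m≤m⊔n _ _
term≤⨆ f (fs x) = ≤-trans (term≤⨆ (λ i → f (fs i)) x) (m≤n⊔m (f fz) _)

⨆-lub : ∀ {n} (f : Fin n → ℕ) {B} → (∀ x → f x ≤ B) → ⨆ f ≤ B
⨆-lub {zero}  f f≤B = z≤n
⨆-lub {suc n} f f≤B = ⊔-lub (f≤B fz) (⨆-lub (λ i → f (fs i)) (λ i → f≤B (fs i)))

⨆-attained : ∀ {n} (f : Fin n → ℕ) → 0 < ⨆ f → Σ (Fin n) λ x → ⨆ f ≡ f x
⨆-attained {suc n} f pos with ≤-total (⨆ (λ i → f (fs i))) (f fz)
... | inj₁ rest≤ = fz , m≥n⇒m⊔n≡m rest≤
... | inj₂ ≤rest with ⨆-attained (λ i → f (fs i)) (subst (0 <_) (m≤n⇒m⊔n≡n ≤rest) pos)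
...   | x , e = fs x , trans (m≤n⇒m⊔n≡n ≤rest) e

dist≤ecc : ∀ {n} (G : Graph n) x u → dist G x u ≤ ecc G u
dist≤ecc G x u = subst (dist G x u ≤_) (sym (maxOver-⨆ G (λ w → dist G w u))) (term≤⨆ (λ w → dist G w u) x)

ecc≤ : ∀ {n} (G : Graph n) u {B} → (∀ w → dist G w u ≤ B) → ecc G u ≤ B
ecc≤ G u bound = subst (_≤ _) (sym (maxOver-⨆ G (λ w → dist G w u))) (⨆-lub (λ w → dist G w u) bound)

maxOver-attained : ∀ {n} (G : Graph n) (f : Fin n → ℕ) {k} → maxOver G f ≡ k → 0 < k → Σ (Fin n) λ x → f x ≡ k
maxOver-attained G f max≡k 0<k with ⨆-attained f (subst (0 <_) (trans (sym max≡k) (maxOver-⨆ G f)) 0<k)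
... | x , ⨆≡fx = x , trans (sym ⨆≡fx) (trans (sym (maxOver-⨆ G f)) max≡k)

diametral-pair : ∀ {n} (G : Graph n) {d} → diameter G ≡ d → 0 < d → Σ (Fin n) λ a → Σ (Fin n) λ b → dist G a b ≡ d
diametral-pair G diam≡d 0<d with maxOver-attained G (ecc G) diam≡d 0<d
... | b , ecc-b≡d with maxOver-attained G (λ w → dist G w b) ecc-b≡d 0<d
...   | a , dist-ab≡d = a , b , dist-ab≡d

-- Double counting over edges

module EdgeSums {n : ℕ} (G : Graph n) where

  edge : Fin n → Fin n → ℕ
  edge u v = if adj G u v then 1 else 0

  edge-sym : ∀ u v → edge u v ≡ edge v u
  edge-sym u v rewrite adj-sym G u v = refl

  edge-weight : ∀ {u v} x → Adj G u v → edge u v * x ≡ x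
  edge-weight x uv rewrite uv = +-identityʳ x

  1≤∑edge : ∀ {u v} (f : Fin n → ℕ) → Adj G u v → f v ≡ 1 → 1 ≤ ∑ (λ w → edge u w * f w)
  1≤∑edge {u} {v} f uv fv≡1 =
    ≤-trans (≤-reflexive (sym (trans (edge-weight (f v) uv) fv≡1))) (term≤∑ (λ w → edge u w * f w) v)

  ∑∑ : (Fin n → Fin n → ℕ) → ℕ
  ∑∑ f = ∑ (λ u → ∑ (f u))

  ∑∑-cong : {f g : Fin n → Fin n → ℕ} → (∀ u v → f u v ≡ g u v) → ∑∑ f ≡ ∑∑ g
  ∑∑-cong f≡g = ∑-cong (λ u → ∑-cong (f≡g u))

  ∑∑-distrib-+ : (f g : Fin n → Fin n → ℕ) → ∑∑ (λ u v → f u v + g u v) ≡ ∑∑ f + ∑∑ g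
  ∑∑-distrib-+ f g = trans (∑-cong (λ u → ∑-distrib-+ (f u) (g u))) (∑-distrib-+ (λ u → ∑ (f u)) (λ u → ∑ (g u)))

  ∑∑-edge-swap : (f : Fin n → Fin n → ℕ) → ∑∑ (λ u v → edge u v * f u v) ≡ ∑∑ (λ u v → edge u v * f v u)
  ∑∑-edge-swap f = trans (∑-comm (λ u v → edge u v * f u v)) (∑∑-cong (λ u v → cong (_* f v u) (edge-sym v u)))

  ∑∑-edge-swapʳ : (f g : Fin n → Fin n → ℕ) →
                  ∑∑ (λ u v → edge u v * (f u v + g u v)) ≡ ∑∑ (λ u v → edge u v * (f u v + g v u))
  ∑∑-edge-swapʳ f g = begin
    ∑∑ (λ u v → edge u v * (f u v + g u v))                ≡⟨ ∑∑-cong (λ u v → *-distribˡ-+ (edge u v) _ _) ⟩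
    ∑∑ (λ u v → edge u v * f u v + edge u v * g u v)       ≡⟨ ∑∑-distrib-+ _ _ ⟩
    ∑∑ (λ u v → edge u v * f u v) + ∑∑ (λ u v → edge u v * g u v)
                                                           ≡⟨ cong (_ +_) (∑∑-edge-swap g) ⟩
    ∑∑ (λ u v → edge u v * f u v) + ∑∑ (λ u v → edge u v * g v u)
                                                           ≡⟨ ∑∑-distrib-+ _ _ ⟨
    ∑∑ (λ u v → edge u v * f u v + edge u v * g v u)       ≡⟨ ∑∑-cong (λ u v → *-distribˡ-+ (edge u v) _ _) ⟨
    ∑∑ (λ u v → edge u v * (f u v + g v u))                ∎
    where open ≡-Reasoning

  ξc-∑∑ : ξc G ≡ ∑∑ (λ u v → edge u v * ecc G u)
  ξc-∑∑ = trans (sumOver-∑ G _) (∑-cong λ u →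
    trans (cong (ecc G u *_) (sumOver-∑ G (edge u)))
          (trans (sym (∑-*ˡ (ecc G u) (edge u))) (∑-cong (λ v → *-comm (ecc G u) (edge u v)))))

  ξc+ξc-∑∑ : ξc G + ξc G ≡ ∑∑ (λ u v → edge u v * (ecc G u + ecc G v))
  ξc+ξc-∑∑ = begin
    ξc G + ξc G                                               ≡⟨ cong₂ _+_ ξc-∑∑ ξc-∑∑ ⟩
    ∑∑ (λ u v → edge u v * ecc G u) + ∑∑ (λ u v → edge u v * ecc G u)
                                                              ≡⟨ ∑∑-distrib-+ _ _ ⟨
    ∑∑ (λ u v → edge u v * ecc G u + edge u v * ecc G u)      ≡⟨ ∑∑-cong (λ u v → *-distribˡ-+ (edge u v) _ _) ⟨
    ∑∑ (λ u v → edge u v * (ecc G u + ecc G u))               ≡⟨ ∑∑-edge-swapʳ (λ u _ → ecc G u) (λ u _ → ecc G u) ⟩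
    ∑∑ (λ u v → edge u v * (ecc G u + ecc G v))               ∎
    where open ≡-Reasoning

  -- The edge uv credits ecc u + ecc v to its endpoint farther from the source of π, and ecc u, ecc v to
  -- u, v when they are level; if π changes by at most one along edges, every edge is thus counted once.
  W : (Fin n → ℕ) → Fin n → Fin n → ℕ
  W π u v = δ (suc (π v)) (π u) (ecc G u) + δ (π v) (π u) (ecc G u) + δ (suc (π v)) (π u) (ecc G v)

  ∑∑-W : (π : Fin n → ℕ) → (∀ u v → Adj G u v → π u ≤ suc (π v)) → ∑∑ (λ u v → edge u v * W π u v) ≡ ξc G
  ∑∑-W π lipschitz = begin
    ∑∑ (λ u v → edge u v * W π u v)
      ≡⟨ ∑∑-edge-swapʳ (λ u v → δ (suc (π v)) (π u) (ecc G u) + δ (π v) (π u) (ecc G u))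
                       (λ u v → δ (suc (π v)) (π u) (ecc G v)) ⟩
    ∑∑ (λ u v → edge u v * (δ (suc (π v)) (π u) (ecc G u) + δ (π v) (π u) (ecc G u) + δ (suc (π u)) (π v) (ecc G u)))
      ≡⟨ ∑∑-cong pointwise ⟩
    ∑∑ (λ u v → edge u v * ecc G u)
      ≡⟨ ξc-∑∑ ⟨
    ξc G ∎
    where
    open ≡-Reasoning
    pointwise : ∀ u v → edge u v * (δ (suc (π v)) (π u) (ecc G u) + δ (π v) (π u) (ecc G u) + δ (suc (π u)) (π v) (ecc G u))
                        ≡ edge u v * ecc G u
    pointwise u v with adj G u v in uv
    ... | false = refl
    ... | true  = cong (1 *_) (δ-adjacent (ecc G u) (lipschitz u v uv) (lipschitz v u (Adj-sym G uv)))

⌈n/2⌉≤1+⌊n/2⌋ : ∀ n → ⌈ n /2⌉ ≤ suc ⌊ n /2⌋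
⌈n/2⌉≤1+⌊n/2⌋ zero          = z≤n
⌈n/2⌉≤1+⌊n/2⌋ (suc zero)    = s≤s z≤n
⌈n/2⌉≤1+⌊n/2⌋ (suc (suc n)) = s≤s (⌈n/2⌉≤1+⌊n/2⌋ n)

-- A vertex at distance i from a has
-- eccentricity at least m i; an edge from layer j to layer j - 1 has eccentricity sum at least L j;
-- a vertex on a geodesic from a to b at layer i is charged R i (L from each end), any other vertex
-- K = 2 (2c + 1).  When d is odd the two middle layers h and c fall one short of K, which is corrected
-- by moving one unit to them from the layers c + 1 and h - 1: this is Y and X.
module Profile (d : ℕ) (3≤d : 3 ≤ d) where

  h c : ℕ
  h = ⌊ d /2⌋
  c = ⌈ d /2⌉

  d≡h+c : d ≡ h + c
  d≡h+c = sym (⌊n/2⌋+⌈n/2⌉≡n d)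

  h≤c : h ≤ c
  h≤c = ⌊n/2⌋≤⌈n/2⌉ d

  c≤1+h : c ≤ suc h
  c≤1+h = ⌈n/2⌉≤1+⌊n/2⌋ d

  c≡h⊎c≡1+h : c ≡ h ⊎ c ≡ suc h
  c≡h⊎c≡1+h with m≤n⇒m<n∨m≡n h≤c
  ... | inj₁ h<c = inj₂ (≤-antisym c≤1+h h<c)
  ... | inj₂ h≡c = inj₁ (sym h≡c)

  d∸h≡c : d ∸ h ≡ c
  d∸h≡c = trans (cong (_∸ h) d≡h+c) (m+n∸m≡n h c)

  c+c≤1+d : c + c ≤ suc d
  c+c≤1+d = ≤-trans (+-monoʳ-≤ c c≤1+h) (≤-reflexive (trans (+-suc c h) (cong suc (trans (+-comm c h) (sym d≡h+c)))))

  1≤h : 1 ≤ h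
  1≤h with h in h≡
  ... | suc _ = s≤s z≤n
  ... | zero  = ⊥-elim (<⇒≱ (≤-trans 3≤d (≤-reflexive d≡h+c)) (≤-trans (≤-reflexive (cong (_+ c) h≡)) (m≤n⇒m≤1+n c≤1)))
    where
    c≤1 : c ≤ 1
    c≤1 = subst (λ z → c ≤ suc z) h≡ c≤1+h

  2≤c : 2 ≤ c
  2≤c with 2 ≤? c
  ... | yes 2≤c = 2≤c
  ... | no  2≰c = ⊥-elim (<⇒≱ (s≤s (+-mono-≤ (≤-trans h≤c c≤1) c≤1)) (≤-trans 3≤d (≤-reflexive d≡h+c)))
    where
    c≤1 : c ≤ 1
    c≤1 = s≤s⁻¹ (≰⇒> 2≰c)

  h≤d : h ≤ d
  h≤d = ≤-trans (m≤m+n h c) (≤-reflexive (sym d≡h+c))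

  h<d : h < d
  h<d = ≤-trans (≤-reflexive (+-comm 1 h)) (≤-trans (+-monoʳ-≤ h (≤-trans (s≤s z≤n) 2≤c)) (≤-reflexive (sym d≡h+c)))

  c<d : c < d
  c<d = ≤-trans (+-monoˡ-≤ c 1≤h) (≤-reflexive (sym d≡h+c))

  pred-h+1+c≡d : pred h + suc c ≡ d
  pred-h+1+c≡d = trans (+-suc (pred h) c) (trans (cong (_+ c) (suc-pred h {{>-nonZero 1≤h}})) (sym d≡h+c))

  parity : ℕ
  parity = c ∸ h

  parity-even : c ≡ h → parity ≡ 0
  parity-even c≡h = trans (cong (_∸ h) c≡h) (n∸n≡0 h)

  parity-odd : c ≡ suc h → parity ≡ 1
  parity-odd c≡1+h = trans (cong (_∸ h) c≡1+h) (m+n∸n≡m 1 h)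

  parity≤1 : parity ≤ 1
  parity≤1 = ≤-trans (∸-monoˡ-≤ h c≤1+h) (≤-reflexive (m+n∸n≡m 1 h))

  m : ℕ → ℕ
  m i = i ⊔ (d ∸ i)

  i≤m : ∀ i → i ≤ m i
  i≤m i = m≤m⊔n i (d ∸ i)

  d∸i≤m : ∀ i → d ∸ i ≤ m i
  d∸i≤m i = m≤n⊔m i (d ∸ i)

  c≤m : ∀ i → c ≤ m i
  c≤m i with c ≤? i
  ... | yes c≤i = ≤-trans c≤i (i≤m i)
  ... | no  c≰i = ≤-trans (m+n≤o⇒m≤o∸n c (subst (_≤ d) (+-comm i c) i+c≤d)) (d∸i≤m i)
    where
    i+c≤d : i + c ≤ d
    i+c≤d = s≤s⁻¹ (≤-trans (+-monoˡ-≤ c (≰⇒> c≰i)) c+c≤1+d)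

  m-≤-half : ∀ {i j} → i + j ≡ d → i ≤ j → m i ≡ j
  m-≤-half {i} {j} i+j≡d i≤j = trans (cong (i ⊔_) (trans (cong (_∸ i) (sym i+j≡d)) (m+n∸m≡n i j))) (m≤n⇒m⊔n≡n i≤j)

  m-≥-half : ∀ {i j} → i + j ≡ d → j ≤ i → m i ≡ i
  m-≥-half {i} {j} i+j≡d j≤i = trans (cong (i ⊔_) (trans (cong (_∸ i) (sym i+j≡d)) (m+n∸m≡n i j))) (m≥n⇒m⊔n≡m j≤i)

  m-mirror : ∀ {i} → i ≤ d → m (d ∸ i) ≡ m i
  m-mirror {i} i≤d = trans (cong ((d ∸ i) ⊔_) (m∸[m∸n]≡n i≤d)) (⊔-comm (d ∸ i) i)

  ∣j-i∣≤m : ∀ {i j} → j ≤ d → ∣ j - i ∣ ≤ m i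
  ∣j-i∣≤m {i} {j} j≤d with ≤-total i j
  ... | inj₁ i≤j = ≤-trans (≤-reflexive (m≤n⇒∣n-m∣≡n∸m i≤j)) (≤-trans (∸-monoˡ-≤ i j≤d) (d∸i≤m i))
  ... | inj₂ j≤i = ≤-trans (≤-reflexive (m≤n⇒∣m-n∣≡n∸m j≤i)) (≤-trans (m∸n≤m i j) (i≤m i))

  1+∣h-i∣≤m : ∀ {i} → i ≤ d → suc ∣ h - i ∣ ≤ m i
  1+∣h-i∣≤m {i} i≤d with ≤-total h i
  ... | inj₁ h≤i = ≤-trans (s≤s (≤-reflexive (m≤n⇒∣m-n∣≡n∸m h≤i))) (≤-trans (∸-monoʳ-< 1≤h h≤i) (i≤m i))
  ... | inj₂ i≤h = ≤-trans (s≤s (≤-reflexive (m≤n⇒∣n-m∣≡n∸m i≤h)))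
                           (≤-trans (≤-reflexive (sym (+-∸-assoc 1 i≤h))) (≤-trans (∸-monoˡ-≤ i h<d) (d∸i≤m i)))

  m-h≡c : m h ≡ c
  m-h≡c = m-≤-half (sym d≡h+c) h≤c

  L : ℕ → ℕ
  L zero    = 0
  L (suc j) = m (suc j) + m j

  L-pred : ∀ {j} → 1 ≤ j → L j ≡ m j + m (pred j)
  L-pred {suc j} _ = refl

  c≤L : ∀ {j} → 1 ≤ j → c ≤ L j
  c≤L {j} 1≤j = ≤-trans (c≤m j) (≤-trans (m≤m+n _ _) (≤-reflexive (sym (L-pred 1≤j))))

  fromBothEnds : (ℕ → ℕ) → ℕ → ℕ
  fromBothEnds f i = f i + f (d ∸ i)

  fromBothEnds-mirror : ∀ f {i} → i ≤ d → fromBothEnds f (d ∸ i) ≡ fromBothEnds f i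
  fromBothEnds-mirror f {i} i≤d = trans (cong (λ z → f (d ∸ i) + f z) (m∸[m∸n]≡n i≤d)) (+-comm (f (d ∸ i)) (f i))

  ∑-fromBothEnds-δ : ∀ {k} → k ≤ d → ∑ℕ (suc d) (fromBothEnds (λ i → δ i k 1)) ≡ 2
  ∑-fromBothEnds-δ {k} k≤d = trans (∑ℕ-distrib-+ (suc d) (λ i → δ i k 1) (λ i → δ (d ∸ i) k 1)) (cong₂ _+_
    (∑ℕ-δ′ (suc d) k (λ _ → 1) (s≤s k≤d))
    (trans (∑ℕ-cong (suc d) (λ i i<1+d → δ-cong-⇔ 1 (to (s≤s⁻¹ i<1+d)) from))
           (∑ℕ-δ (suc d) (d ∸ k) (λ _ → 1) (s≤s (m∸n≤m d k)))))
    where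
    to : ∀ {i} → i ≤ d → d ∸ i ≡ k → d ∸ k ≡ i
    to i≤d refl = m∸[m∸n]≡n i≤d
    from : ∀ {i} → d ∸ k ≡ i → d ∸ i ≡ k
    from refl = m∸[m∸n]≡n k≤d

  R : ℕ → ℕ
  R = fromBothEnds L

  Kh K : ℕ
  Kh = c + suc c
  K  = Kh + Kh

  K≡ : K ≡ (suc c + c) + (suc c + c)
  K≡ = cong₂ _+_ (+-comm c (suc c)) (+-comm c (suc c))

  K≤c+c+[c+c+c] : K ≤ (c + c) + (c + c + c)
  K≤c+c+[c+c+c] with c | 2≤c
  ... | suc zero    | s≤s ()
  ... | suc (suc t) | _ = ≤-trans (m≤m+n _ t) (≤-reflexive (identity t))
    where
    identity : ∀ t → (2 + t + (3 + t)) + (2 + t + (3 + t)) + t ≡ (2 + t + (2 + t)) + (2 + t + (2 + t) + (2 + t))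
    identity = solve 1 (λ t → (con 2 :+ t :+ (con 3 :+ t)) :+ (con 2 :+ t :+ (con 3 :+ t)) :+ t
                          := (con 2 :+ t :+ (con 2 :+ t)) :+ (con 2 :+ t :+ (con 2 :+ t) :+ (con 2 :+ t))) refl

  X Y : ℕ → ℕ
  X i = parity * fromBothEnds (λ i → δ i (suc c) 1) i
  Y i = parity * fromBothEnds (λ i → δ i c 1) i

  ρ : ℕ → ℕ
  ρ i = R i + Y i ∸ X i

  X≤2 : ∀ i → X i ≤ 2
  X≤2 i = *-mono-≤ parity≤1 (+-mono-≤ (δ-≤ i (suc c) 1) (δ-≤ (d ∸ i) (suc c) 1))

  2≤R : ∀ i → 2 ≤ R i
  2≤R zero    = ≤-trans 2≤c (c≤L (≤-trans (s≤s z≤n) 3≤d))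
  2≤R (suc i) = ≤-trans 2≤c (≤-trans (c≤L (s≤s z≤n)) (m≤m+n _ _))

  ρ+X≡R+Y : ∀ i → ρ i + X i ≡ R i + Y i
  ρ+X≡R+Y i = m∸n+n≡m (≤-trans (X≤2 i) (≤-trans (2≤R i) (m≤m+n _ _)))

  ∑X≡∑Y : ∑ℕ (suc d) X ≡ ∑ℕ (suc d) Y
  ∑X≡∑Y = begin
    ∑ℕ (suc d) X                                            ≡⟨ ∑ℕ-*ˡ (suc d) parity (fromBothEnds (λ i → δ i (suc c) 1)) ⟩
    parity * ∑ℕ (suc d) (fromBothEnds (λ i → δ i (suc c) 1)) ≡⟨ cong (parity *_) (∑-fromBothEnds-δ c<d) ⟩
    parity * 2                                              ≡⟨ cong (parity *_) (∑-fromBothEnds-δ (<⇒≤ c<d)) ⟨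
    parity * ∑ℕ (suc d) (fromBothEnds (λ i → δ i c 1))       ≡⟨ ∑ℕ-*ˡ (suc d) parity (fromBothEnds (λ i → δ i c 1)) ⟨
    ∑ℕ (suc d) Y                                            ∎
    where open ≡-Reasoning

  K+2≤R : ∀ j → c < j → j < d → K + 2 ≤ R j
  K+2≤R (suc j) c<1+j 1+j<d = begin
    K + 2                                              ≡⟨ K+2 c ⟩
    suc c + c + (suc c + suc (suc c))                  ≤⟨ +-mono-≤ (+-mono-≤ (≤-trans c<1+j (i≤m (suc j))) (≤-trans (s≤s⁻¹ c<1+j) (i≤m j)))
                                                                   (+-mono-≤ far-end far-end-pred) ⟩
    L (suc j) + (m (d ∸ suc j) + m (pred (d ∸ suc j)))  ≡⟨ cong (L (suc j) +_) (L-pred (m<n⇒0<n∸m 1+j<d)) ⟨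
    R (suc j)                                          ∎
    where
    open ≤-Reasoning
    K+2 : ∀ c → (c + suc c) + (c + suc c) + 2 ≡ suc c + c + (suc c + suc (suc c))
    K+2 = solve 1 (λ c → (c :+ (con 1 :+ c)) :+ (c :+ (con 1 :+ c)) :+ con 2
                      := (con 1 :+ c) :+ c :+ ((con 1 :+ c) :+ (con 2 :+ c))) refl
    far-end : suc c ≤ m (d ∸ suc j)
    far-end = ≤-trans c<1+j (≤-trans (≤-reflexive (sym (m∸[m∸n]≡n (<⇒≤ 1+j<d)))) (d∸i≤m (d ∸ suc j)))
    far-end-pred : suc (suc c) ≤ m (pred (d ∸ suc j))
    far-end-pred = ≤-trans (s≤s c<1+j)
                     (≤-trans (≤-reflexive (sym (trans (cong (d ∸_) (pred[m∸n]≡m∸[1+n] d (suc j))) (m∸[m∸n]≡n 1+j<d))))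
                              (d∸i≤m (pred (d ∸ suc j))))

  R-mirror : ∀ {i} → i ≤ d → R (d ∸ i) ≡ R i
  R-mirror i≤d = fromBothEnds-mirror L i≤d

  X-mirror : ∀ {i} → i ≤ d → X (d ∸ i) ≡ X i
  X-mirror i≤d = cong (parity *_) (fromBothEnds-mirror (λ i → δ i (suc c) 1) i≤d)

  Y-mirror : ∀ {i} → i ≤ d → Y (d ∸ i) ≡ Y i
  Y-mirror i≤d = cong (parity *_) (fromBothEnds-mirror (λ i → δ i c 1) i≤d)

  R-h : R h ≡ (c + suc c) + (c + suc h)
  R-h = cong₂ _+_ (trans (L-pred 1≤h) (cong₂ _+_ m-h≡c (m-≤-half pred-h+1+c≡d pred-h≤1+c)))
                  (trans (cong L d∸h≡c) (trans (L-pred (≤-trans (s≤s z≤n) 2≤c))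
                         (cong₂ _+_ (m-≥-half (trans (+-comm c h) (sym d≡h+c)) h≤c) (m-≤-half pred-c+1+h≡d pred-c≤1+h))))
    where
    pred-h≤1+c : pred h ≤ suc c
    pred-h≤1+c = ≤-trans pred[n]≤n (m≤n⇒m≤1+n h≤c)
    pred-c+1+h≡d : pred c + suc h ≡ d
    pred-c+1+h≡d = trans (+-suc (pred c) h) (trans (cong (_+ h) (suc-pred c {{>-nonZero (≤-trans (s≤s z≤n) 2≤c)}}))
                                                   (trans (+-comm c h) (sym d≡h+c)))
    pred-c≤1+h : pred c ≤ suc h
    pred-c≤1+h = m≤n⇒m≤1+n (pred-mono-≤ c≤1+h)

  K+X≤R+Y-at-h : K + X h ≤ R h + Y h
  K+X≤R+Y-at-h = begin
    K + X h                                         ≡⟨ cong (K +_) X-h≡0 ⟩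
    K + 0                                           ≡⟨ +-identityʳ K ⟩
    (c + suc c) + (c + suc c)                       ≡⟨ cong (λ z → (c + suc c) + (c + suc z)) (m+[n∸m]≡n h≤c) ⟨
    (c + suc c) + (c + suc (h + parity))            ≡⟨ shift (c + suc c) c h parity ⟩
    (c + suc c) + (c + suc h) + parity              ≤⟨ +-mono-≤ (≤-reflexive (sym R-h)) parity≤Y-h ⟩
    R h + Y h                                       ∎
    where
    open ≤-Reasoning
    shift : ∀ a c h p → a + (c + suc (h + p)) ≡ a + (c + suc h) + p
    shift = solve 4 (λ a c h p → a :+ (c :+ (con 1 :+ (h :+ p))) := a :+ (c :+ (con 1 :+ h)) :+ p) refl
    X-h≡0 : X h ≡ 0
    X-h≡0 = trans (cong₂ (λ x y → parity * (x + y))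
                         (δ-≢ 1 (<⇒≢ (s≤s h≤c)))
                         (trans (cong (λ z → δ z (suc c) 1) d∸h≡c) (δ-≢ 1 (≢-sym (1+n≢n {c})))))
                  (*-zeroʳ parity)
    parity≤Y-h : parity ≤ Y h
    parity≤Y-h = ≤-trans (≤-reflexive (sym (*-identityʳ parity)))
                         (*-monoʳ-≤ parity (≤-trans (≤-reflexive (sym (δ-≡ 1 d∸h≡c))) (m≤n+m _ _)))

  K+X≤R+Y-at-c : K + X c ≤ R c + Y c
  K+X≤R+Y-at-c = subst (λ i → K + X i ≤ R i + Y i) d∸h≡c
               (subst₂ (λ x y → K + x ≤ y) (sym (X-mirror h≤d)) (sym (cong₂ _+_ (R-mirror h≤d) (Y-mirror h≤d))) K+X≤R+Y-at-h)

  K+X≤R+Y-far : ∀ {i} → c < i → i < d → K + X i ≤ R i + Y i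
  K+X≤R+Y-far {i} c<i i<d = ≤-trans (+-monoʳ-≤ K (X≤2 i)) (≤-trans (K+2≤R i c<i i<d) (m≤m+n _ _))

  K+X≤R+Y : ∀ j → 0 < j → j < d → K + X j ≤ R j + Y j
  K+X≤R+Y j 0<j j<d with c <? j
  ... | yes c<j = K+X≤R+Y-far c<j j<d
  ... | no  c≮j with j <? h
  ...   | yes j<h = subst₂ (λ x y → K + x ≤ y) (X-mirror j≤d) (cong₂ _+_ (R-mirror j≤d) (Y-mirror j≤d))
                      (K+X≤R+Y-far (subst (_< d ∸ j) d∸h≡c (∸-monoʳ-< j<h h≤d)) (∸-monoʳ-< 0<j j≤d))
    where
    j≤d : j ≤ d
    j≤d = <⇒≤ j<d
  ...   | no  j≮h with m≤n⇒m<n∨m≡n (≮⇒≥ j≮h)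
  ...     | inj₂ refl = K+X≤R+Y-at-h
  ...     | inj₁ h<j rewrite ≤-antisym (≮⇒≥ c≮j) (≤-trans c≤1+h h<j) = K+X≤R+Y-at-c

  K≤ρ : ∀ j → 0 < j → j < d → K ≤ ρ j
  K≤ρ j 0<j j<d = m+n≤o⇒m≤o∸n K (K+X≤R+Y j 0<j j<d)

-- The lower bound for G

m*n≤o⇒m+n≤o+1 : ∀ {x y z} → 1 ≤ x → 1 ≤ y → x * y ≤ z → x + y ≤ z + 1
m*n≤o⇒m+n≤o+1 {x} {suc y} {z} 1≤x _ xy≤z = begin
  x + suc y          ≡⟨ +-suc x y ⟩
  suc (x + y)        ≤⟨ s≤s (+-monoʳ-≤ x (≤-trans (≤-reflexive (sym (*-identityˡ y))) (*-monoˡ-≤ y 1≤x))) ⟩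
  suc (x + x * y)    ≡⟨ cong suc (*-suc x y) ⟨
  suc (x * suc y)    ≤⟨ s≤s xy≤z ⟩
  suc z              ≡⟨ +-comm 1 z ⟩
  z + 1              ∎
  where open ≤-Reasoning

both≡ : ∀ {x y k} → x ≤ k → y ≤ k → k + k ≤ x + y → x ≡ k × y ≡ k
both≡ {x} {y} {k} x≤k y≤k k+k≤x+y = ≤-antisym x≤k (+-cancelʳ-≤ y k x (≤-trans (+-monoʳ-≤ k y≤k) k+k≤x+y)) ,
                                    ≤-antisym y≤k (+-cancelˡ-≤ x k y (≤-trans (+-monoˡ-≤ k x≤k) k+k≤x+y))

-- Layers by the distance p to a; with q the distance to b, p u + q u ≡ d says u lies on an a–b geodesic.
module Layering {n : ℕ} (G : Graph n) (conn : Connected G) (d : ℕ) (3≤d : 3 ≤ d)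
                (a b : Fin n) (dist-ab : dist G a b ≡ d) where

  open Profile d 3≤d
  open Metric G conn
  open EdgeSums G

  e p q : Fin n → ℕ
  e = ecc G
  p u = dist G u a
  q u = dist G u b

  p≤e : ∀ u → p u ≤ e u
  p≤e u = subst (_≤ e u) (dist-sym a u) (dist≤ecc G a u)

  q≤e : ∀ u → q u ≤ e u
  q≤e u = subst (_≤ e u) (dist-sym b u) (dist≤ecc G b u)

  d≤p+q : ∀ u → d ≤ p u + q u
  d≤p+q u = subst (_≤ p u + q u) dist-ab (subst (λ z → dist G a b ≤ z + q u) (dist-sym a u) (dist-triangle a u b))

  p-a : p a ≡ 0
  p-a = dist-self G a

  q-b : q b ≡ 0
  q-b = dist-self G b

  q-a : q a ≡ d
  q-a = dist-ab

  p-b : p b ≡ d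
  p-b = trans (dist-sym b a) dist-ab

  c≤e : ∀ u → c ≤ e u
  c≤e u with c ≤? e u
  ... | yes c≤eu = c≤eu
  ... | no  c≰eu = ⊥-elim (<⇒≱ (s≤s⁻¹ (≤-trans 2+eu+eu≤c+c c+c≤1+d)) (≤-trans (d≤p+q u) (+-mono-≤ (p≤e u) (q≤e u))))
    where
    2+eu+eu≤c+c : suc (suc (e u + e u)) ≤ c + c
    2+eu+eu≤c+c = ≤-trans (≤-reflexive (cong suc (sym (+-suc (e u) (e u))))) (+-mono-≤ (≰⇒> c≰eu) (≰⇒> c≰eu))

  m≤e : ∀ u → m (p u) ≤ e u
  m≤e u = ⊔-lub (p≤e u) (≤-trans (m≤n+o⇒m∸n≤o d (p u) (d≤p+q u)) (q≤e u))

  credit : Fin n → ℕ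
  credit u = ∑ (λ v → edge u v * W p u v)

  W≤credit : ∀ {u v} → Adj G u v → W p u v ≤ credit u
  W≤credit {u} {v} uv = ≤-trans (≤-reflexive (sym (edge-weight (W p u v) uv))) (term≤∑ (λ v → edge u v * W p u v) v)

  W-toward-a : ∀ {u x} → suc (p x) ≡ p u → e u + e x ≤ W p u x
  W-toward-a {u} {x} px+1≡pu rewrite δ-≡ (e u) px+1≡pu | δ-≡ (e x) px+1≡pu = +-monoˡ-≤ (e x) (m≤m+n (e u) _)

  W-level : ∀ {u x} → p x ≡ p u → e u ≤ W p u x
  W-level {u} {x} px≡pu rewrite δ-≡ (e u) px≡pu =
    ≤-trans (m≤n+m (e u) (δ (suc (p x)) (p u) (e u))) (m≤m+n _ (δ (suc (p x)) (p u) (e x)))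

  toward-a : ∀ u → u ≢ a → Σ (Fin n) λ x → Adj G u x × suc (p x) ≡ p u
  toward-a u u≢a with p u in pu
  ... | zero  = ⊥-elim (u≢a (dist-zero⁻ u a pu))
  ... | suc k with dist-suc⁻ u a k pu
  ...   | x , ux , px≡k = x , ux , cong suc px≡k

  e+e≤credit : ∀ {u x} → Adj G u x → suc (p x) ≡ p u → e u + e x ≤ credit u
  e+e≤credit ux px+1≡pu = ≤-trans (W-toward-a px+1≡pu) (W≤credit ux)

  L≤credit : ∀ u → L (p u) ≤ credit u
  L≤credit u with u ≟ a
  ... | yes refl = subst (λ z → L z ≤ credit a) (sym p-a) z≤n
  ... | no  u≢a with toward-a u u≢a
  ...   | x , ux , px+1≡pu = begin
    L (p u)            ≡⟨ cong L px+1≡pu ⟨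
    m (suc (p x)) + m (p x)
                       ≤⟨ +-mono-≤ (subst (λ z → m z ≤ e u) (sym px+1≡pu) (m≤e u)) (m≤e x) ⟩
    e u + e x          ≤⟨ e+e≤credit ux px+1≡pu ⟩
    credit u           ∎
    where open ≤-Reasoning

  credit-two-neighbours : ∀ {u x y} → Adj G u x → p x ≡ p u → Adj G u y → suc (p y) ≡ p u → e u + e y + e u ≤ credit u
  credit-two-neighbours {u} {x} {y} ux px≡pu uy py+1≡pu =
    ≤-trans (+-mono-≤ (≤-trans (W-toward-a py+1≡pu) (≤-reflexive (sym (edge-weight _ uy))))
                      (≤-trans (W-level px≡pu) (≤-reflexive (sym (edge-weight _ ux)))))
            (terms≤∑ (λ v → edge u v * W p u v) y x y≢x)
    where
    y≢x : y ≢ x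
    y≢x refl = 1+n≢n (trans py+1≡pu (sym px≡pu))

  onLayer : ℕ → Fin n → ℕ
  onLayer i u = δ (p u) i (δ (p u + q u) d 1)

  onLayer-≡ : ∀ {i u} → p u ≡ i → p u + q u ≡ d → onLayer i u ≡ 1
  onLayer-≡ {i} {u} pu≡i geodesic rewrite δ-≡ 1 geodesic = δ-≡ 1 pu≡i

  onLayer-≢ : ∀ {i u} → p u ≢ i → onLayer i u ≡ 0
  onLayer-≢ pu≢i = δ-≢ _ pu≢i

  onLayer-off : ∀ {i u} → p u + q u ≢ d → onLayer i u ≡ 0
  onLayer-off {i} {u} off = trans (cong (δ (p u) i) (δ-≢ 1 off)) (δ-zero (p u) i)

  onLayer≤1 : ∀ i u → onLayer i u ≤ 1
  onLayer≤1 i u = ≤-trans (δ-≤ (p u) i _) (δ-≤ (p u + q u) d 1)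

  -- For odd d every geodesic vertex of layer c + 1 passes one unit to each geodesic neighbour in layer c;
  -- it can afford this because each such edge already credits it L (c + 1).
  transfer : Fin n → Fin n → ℕ
  transfer u v = parity * onLayer (suc c) u * onLayer c v

  paid received : Fin n → ℕ
  paid     u = ∑ (λ v → edge u v * transfer u v)
  received u = ∑ (λ v → edge u v * transfer v u)

  paid-zero : ∀ u → parity * onLayer (suc c) u ≡ 0 → paid u ≡ 0
  paid-zero u vanish = trans (∑-cong (λ v → trans (cong (λ z → edge u v * (z * onLayer c v)) vanish) (*-zeroʳ (edge u v))))
                             (∑-zero {n})

  paid-≢ : ∀ {u} → p u ≢ suc c → paid u ≡ 0
  paid-≢ {u} pu≢1+c = paid-zero u (trans (cong (parity *_) (onLayer-≢ pu≢1+c)) (*-zeroʳ parity))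

  transfer≡1 : ∀ {u v} → c ≡ suc h → p u ≡ suc c → p u + q u ≡ d → p v ≡ c → p v + q v ≡ d → transfer u v ≡ 1
  transfer≡1 odd pu geo-u pv geo-v rewrite parity-odd odd | onLayer-≡ pu geo-u | onLayer-≡ pv geo-v = refl

  transfer≤1 : ∀ u v → transfer u v ≤ 1
  transfer≤1 u v = *-mono-≤ (*-mono-≤ parity≤1 (onLayer≤1 (suc c) u)) (onLayer≤1 c v)

  pin-q : ∀ {x i j} → p x ≡ i → i + j ≡ d → q x ≤ j → q x ≡ j × p x + q x ≡ d
  pin-q {x} {i} {j} px≡i i+j≡d qx≤j = qx≡j , trans (cong₂ _+_ px≡i qx≡j) i+j≡d
    where
    qx≡j : q x ≡ j
    qx≡j = ≤-antisym qx≤j (+-cancelˡ-≤ i j (q x) (subst₂ _≤_ (sym i+j≡d) (cong (_+ q x) px≡i) (d≤p+q x)))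

  pin-p : ∀ {y i j} → q y ≡ j → i + j ≡ d → p y ≤ i → p y ≡ i × p y + q y ≡ d
  pin-p {y} {i} {j} qy≡j i+j≡d py≤i = py≡i , trans (cong₂ _+_ py≡i qy≡j) i+j≡d
    where
    py≡i : p y ≡ i
    py≡i = ≤-antisym py≤i (+-cancelʳ-≤ j i (p y) (subst₂ _≤_ (sym i+j≡d) (cong (p y +_) qy≡j) (d≤p+q y)))

  geodesic-q : ∀ {u i j} → p u ≡ i → i + j ≡ d → p u + q u ≡ d → q u ≡ j
  geodesic-q {u} {i} {j} pu≡i i+j≡d geo = +-cancelˡ-≡ i (q u) j (trans (cong (_+ q u) (sym pu≡i)) (trans geo (sym i+j≡d)))

  received-pos : ∀ {u} → c ≡ suc h → p u ≡ c → p u + q u ≡ d → 1 ≤ received u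
  received-pos {u} odd pu≡c geo-u with dist-suc⁻ u b (pred h) qu≡1+pred-h
    where
    qu≡1+pred-h : q u ≡ suc (pred h)
    qu≡1+pred-h = trans (geodesic-q pu≡c (trans (+-comm c h) (sym d≡h+c)) geo-u) (sym (suc-pred h {{>-nonZero 1≤h}}))
  ... | y , uy , qy≡pred-h with pin-p qy≡pred-h (trans (+-comm (suc c) (pred h)) pred-h+1+c≡d) py≤1+c
    where
    py≤1+c : p y ≤ suc c
    py≤1+c = subst (λ z → p y ≤ suc z) pu≡c (dist-adj y u a (Adj-sym G uy))
  ...   | py≡1+c , geo-y = 1≤∑edge (λ w → transfer w u) uy (transfer≡1 odd py≡1+c geo-y pu≡c geo-u)

  paid-pos : ∀ {u} → c ≡ suc h → p u ≡ suc c → p u + q u ≡ d → 1 ≤ paid u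
  paid-pos {u} odd pu≡1+c geo-u with dist-suc⁻ u a c pu≡1+c
  ... | x , ux , px≡c with pin-q px≡c (trans (+-comm c h) (sym d≡h+c)) qx≤h
    where
    qx≤h : q x ≤ h
    qx≤h = subst (q x ≤_) (trans (cong suc (geodesic-q pu≡1+c (trans (+-comm (suc c) (pred h)) pred-h+1+c≡d) geo-u))
                                 (suc-pred h {{>-nonZero 1≤h}}))
                          (dist-adj x u b (Adj-sym G ux))
  ...   | _ , geo-x = 1≤∑edge (transfer u) ux (transfer≡1 odd pu≡1+c geo-u px≡c geo-x)

  L-paid≤credit : ∀ {u} → p u ≡ suc c → L (suc c) * paid u ≤ credit u
  L-paid≤credit {u} pu≡1+c = ≤-trans (≤-reflexive (sym (∑-*ˡ (L (suc c)) (λ v → edge u v * transfer u v)))) (∑-mono-≤ pointwise)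
    where
    pointwise : ∀ v → L (suc c) * (edge u v * transfer u v) ≤ edge u v * W p u v
    pointwise v with adj G u v in uv
    ... | false = ≤-reflexive (*-zeroʳ (L (suc c)))
    ... | true with p v ≟ℕ c
    ...   | no  pv≢c = ≤-trans (≤-reflexive (trans (cong (λ z → L (suc c) * (1 * (parity * onLayer (suc c) u * z))) (onLayer-≢ pv≢c))
                                          (trans (cong (λ z → L (suc c) * (1 * z)) (*-zeroʳ (parity * onLayer (suc c) u)))
                                                 (*-zeroʳ (L (suc c)))))) z≤n
    ...   | yes pv≡c = begin
      L (suc c) * (1 * transfer u v)   ≤⟨ *-monoʳ-≤ (L (suc c)) (≤-trans (≤-reflexive (*-identityˡ _)) (transfer≤1 u v)) ⟩
      L (suc c) * 1                    ≡⟨ *-identityʳ _ ⟩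
      m (suc c) + m c                  ≤⟨ +-mono-≤ (subst (λ z → m z ≤ e u) pu≡1+c (m≤e u)) (subst (λ z → m z ≤ e v) pv≡c (m≤e v)) ⟩
      e u + e v                        ≤⟨ W-toward-a (trans (cong suc pv≡c) (sym pu≡1+c)) ⟩
      W p u v                          ≡⟨ *-identityˡ _ ⟨
      1 * W p u v                      ∎
      where open ≤-Reasoning

  credit-geodesic : ∀ u → p u + q u ≡ d →
                    L (p u) + parity * δ (p u) c 1 + paid u ≤ credit u + received u + parity * δ (p u) (suc c) 1
  credit-geodesic u geo with c≡h⊎c≡1+h
  ... | inj₁ even = begin
    L (p u) + parity * δ (p u) c 1 + paid u    ≡⟨ cong₂ (λ x y → L (p u) + x * δ (p u) c 1 + y) (parity-even even)
                                                        (paid-zero u (cong (_* onLayer (suc c) u) (parity-even even))) ⟩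
    L (p u) + 0 + 0                            ≡⟨ trans (+-identityʳ _) (+-identityʳ _) ⟩
    L (p u)                                    ≤⟨ L≤credit u ⟩
    credit u                                   ≤⟨ ≤-trans (m≤m+n _ _) (m≤m+n _ _) ⟩
    credit u + received u + parity * δ (p u) (suc c) 1  ∎
    where open ≤-Reasoning
  ... | inj₂ odd with p u ≟ℕ c | p u ≟ℕ suc c
  ...   | yes pu≡c | _ = begin
    L (p u) + parity * δ (p u) c 1 + paid u    ≡⟨ cong₂ (λ x y → L (p u) + x * y + paid u) (parity-odd odd) (δ-≡ 1 pu≡c) ⟩
    L (p u) + 1 + paid u                       ≡⟨ cong (L (p u) + 1 +_) (paid-≢ pu≢1+c) ⟩
    L (p u) + 1 + 0                            ≡⟨ +-identityʳ _ ⟩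
    L (p u) + 1                                ≤⟨ +-mono-≤ (L≤credit u) (received-pos odd pu≡c geo) ⟩
    credit u + received u                      ≤⟨ m≤m+n _ _ ⟩
    credit u + received u + parity * δ (p u) (suc c) 1  ∎
    where
    open ≤-Reasoning
    pu≢1+c : p u ≢ suc c
    pu≢1+c pu≡1+c = 1+n≢n (trans (sym pu≡1+c) pu≡c)
  ...   | no pu≢c | yes pu≡1+c = begin
    L (p u) + parity * δ (p u) c 1 + paid u    ≡⟨ cong₂ (λ x y → x + parity * y + paid u) (cong L pu≡1+c) (δ-≢ 1 pu≢c) ⟩
    L (suc c) + parity * 0 + paid u            ≡⟨ cong (λ z → z + paid u) (trans (cong (L (suc c) +_) (*-zeroʳ parity)) (+-identityʳ _)) ⟩
    L (suc c) + paid u                         ≤⟨ m*n≤o⇒m+n≤o+1 1≤L (paid-pos odd pu≡1+c geo) (L-paid≤credit pu≡1+c) ⟩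
    credit u + 1                               ≤⟨ +-mono-≤ (m≤m+n _ _) (≤-reflexive (sym (cong₂ _*_ (parity-odd odd) (δ-≡ 1 pu≡1+c)))) ⟩
    credit u + received u + parity * δ (p u) (suc c) 1  ∎
    where
    open ≤-Reasoning
    1≤L : 1 ≤ L (suc c)
    1≤L = ≤-trans (≤-trans (s≤s z≤n) 2≤c) (c≤L (s≤s z≤n))
  ...   | no pu≢c | no pu≢1+c = begin
    L (p u) + parity * δ (p u) c 1 + paid u    ≡⟨ cong₂ (λ x y → L (p u) + parity * x + y) (δ-≢ 1 pu≢c)
                                                        (paid-≢ pu≢1+c) ⟩
    L (p u) + parity * 0 + 0                   ≡⟨ trans (+-identityʳ _) (trans (cong (L (p u) +_) (*-zeroʳ parity)) (+-identityʳ _)) ⟩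
    L (p u)                                    ≤⟨ L≤credit u ⟩
    credit u                                   ≤⟨ ≤-trans (m≤m+n _ _) (m≤m+n _ _) ⟩
    credit u + received u + parity * δ (p u) (suc c) 1  ∎
    where open ≤-Reasoning

  paid-off : ∀ {u} → p u + q u ≢ d → paid u ≡ 0
  paid-off {u} off = paid-zero u (trans (cong (parity *_) (onLayer-off off)) (*-zeroʳ parity))

  geodesic-step : ∀ {u i} → p u ≡ suc i → p u + q u ≡ d → Σ (Fin n) λ x → p x ≡ i × p x + q x ≡ d
  geodesic-step {u} {i} pu≡1+i geo with dist-suc⁻ u a i pu≡1+i
  ... | x , ux , px≡i = x , px≡i , proj₂ (pin-q px≡i i+1+qu≡d (dist-adj x u b (Adj-sym G ux)))
    where
    i+1+qu≡d : i + suc (q u) ≡ d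
    i+1+qu≡d = trans (+-suc i (q u)) (trans (cong (_+ q u) (sym pu≡1+i)) geo)

  geodesic-at : ∀ j → j ≤ d → Σ (Fin n) λ u → p u + j ≡ d × p u + q u ≡ d
  geodesic-at zero    _ = b , trans (+-identityʳ _) p-b , trans (cong₂ _+_ p-b q-b) (+-identityʳ d)
  geodesic-at (suc j) 1+j≤d with geodesic-at j (≤-trans (n≤1+n j) 1+j≤d)
  ... | u , pu+j≡d , geo with p u in pu
  ...   | zero  = ⊥-elim (<⇒≱ 1+j≤d (≤-reflexive (sym pu+j≡d)))
  ...   | suc i with geodesic-step pu (trans (cong (_+ q u) pu) geo)
  ...     | x , px≡i , geo-x = x , trans (cong (_+ suc j) px≡i) (trans (+-suc i j) pu+j≡d) , geo-x

  geodesic-on : ∀ i → i ≤ d → Σ (Fin n) λ u → onLayer i u ≡ 1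
  geodesic-on i i≤d with geodesic-at (d ∸ i) (m∸n≤m d i)
  ... | u , pu+[d∸i]≡d , geo = u , onLayer-≡ (+-cancelʳ-≡ (d ∸ i) (p u) i (trans pu+[d∸i]≡d (sym (m+[n∸m]≡n i≤d)))) geo

  ∑ℕ≤∑-layers : (f : ℕ → ℕ) → ∑ℕ (suc d) f ≤ ∑ (λ u → ∑ℕ (suc d) (λ j → onLayer j u * f j))
  ∑ℕ≤∑-layers f = ≤-trans (∑ℕ-mono-≤ (suc d) (λ j j<1+d → represented j (s≤s⁻¹ j<1+d)))
                          (≤-reflexive (sym (∑-∑ℕ-comm (suc d) (λ u j → onLayer j u * f j))))
    where
    represented : ∀ j → j ≤ d → f j ≤ ∑ (λ u → onLayer j u * f j)
    represented j j≤d with geodesic-on j j≤d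
    ... | w , on-w = ≤-trans (≤-reflexive (trans (sym (*-identityˡ (f j))) (cong (_* f j) (sym on-w))))
                             (term≤∑ (λ u → onLayer j u * f j) w)

  onLayer-* : ∀ j u x → onLayer j u * x ≡ δ (p u) j (δ (p u + q u) d 1 * x)
  onLayer-* j u x = δ-*ʳ (p u) j _ x

  ∑ℕ-onLayer : ∀ {u} → p u + q u ≡ d → (f : ℕ → ℕ) → ∑ℕ (suc d) (λ j → onLayer j u * f j) ≡ f (p u)
  ∑ℕ-onLayer {u} geo f =
    trans (∑ℕ-cong (suc d) (λ j _ → trans (onLayer-* j u (f j))
                                          (cong (δ (p u) j) (trans (cong (_* f j) (δ-≡ 1 geo)) (*-identityˡ (f j))))))
          (∑ℕ-δ (suc d) (p u) f (s≤s (≤-trans (m≤m+n (p u) (q u)) (≤-reflexive geo))))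

  ∑ℕ-onLayer-off : ∀ {u} → p u + q u ≢ d → (f : ℕ → ℕ) → ∑ℕ (suc d) (λ j → onLayer j u * f j) ≡ 0
  ∑ℕ-onLayer-off {u} off f =
    trans (∑ℕ-cong (suc d) {g = λ _ → 0} (λ j _ → cong (_* f j) (onLayer-off {j} {u} off))) (∑ℕ-zero (suc d))

  ∑ℕ-onLayer≤ : ∀ u (f : ℕ → ℕ) → ∑ℕ (suc d) (λ j → onLayer j u * f j) ≤ f (p u)
  ∑ℕ-onLayer≤ u f = ≤-trans (∑ℕ-mono-≤ (suc d) (λ j _ → ≤-trans (≤-reflexive (onLayer-* j u (f j)))
                                                     (δ-mono-≤ (p u) j (≤-trans (*-monoˡ-≤ (f j) (δ-≤ (p u + q u) d 1))
                                                                                (≤-reflexive (*-identityˡ (f j)))))))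
                            (∑ℕ-δ≤ (suc d) (p u) f)

module LowerBound {n : ℕ} (G : Graph n) (conn : Connected G) (d : ℕ) (3≤d : 3 ≤ d)
                  (a b : Fin n) (dist-ab : dist G a b ≡ d) where

  open Profile d 3≤d
  open Metric G conn
  open EdgeSums G
  module A = Layering G conn d 3≤d a b dist-ab
  module B = Layering G conn d 3≤d b a (trans (dist-sym b a) dist-ab)
  open A using (e; p; q)

  credit₂ paid₂ received₂ charge : Fin n → ℕ
  credit₂   u = A.credit u + B.credit u
  paid₂     u = A.paid u + B.paid u
  received₂ u = A.received u + B.received u
  charge    u = if p u + q u ≡ᵇ d then ρ (p u) else K

  charge-geodesic : ∀ u → p u + q u ≡ d → charge u + paid₂ u ≤ credit₂ u + received₂ u
  charge-geodesic u geo = +-cancelʳ-≤ (X (p u)) _ _ (begin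
    charge u + paid₂ u + X (p u)    ≡⟨ cong (λ z → z + paid₂ u + X (p u)) (if≡ᵇ-≡ geo) ⟩
    ρ (p u) + paid₂ u + X (p u)     ≡⟨ +-comm-middle (ρ (p u)) (paid₂ u) (X (p u)) ⟩
    ρ (p u) + X (p u) + paid₂ u     ≡⟨ cong (_+ paid₂ u) (ρ+X≡R+Y (p u)) ⟩
    R (p u) + Y (p u) + paid₂ u     ≡⟨ cong₂ (λ x y → x + y + paid₂ u) (cong (λ z → L (p u) + L z) d∸p≡q)
                                             (trans (cong (λ z → parity * (δ (p u) c 1 + δ z c 1)) d∸p≡q) (*-distribˡ-+ parity _ _)) ⟩
    (L (p u) + L (q u)) + (parity * δ (p u) c 1 + parity * δ (q u) c 1) + paid₂ u
                                    ≡⟨ +-interchange₃ (L (p u)) (parity * δ (p u) c 1) (A.paid u) (L (q u)) (parity * δ (q u) c 1) (B.paid u) ⟨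
    (L (p u) + parity * δ (p u) c 1 + A.paid u) + (L (q u) + parity * δ (q u) c 1 + B.paid u)
                                    ≤⟨ +-mono-≤ (A.credit-geodesic u geo) (B.credit-geodesic u (trans (+-comm (q u) (p u)) geo)) ⟩
    (A.credit u + A.received u + parity * δ (p u) (suc c) 1) + (B.credit u + B.received u + parity * δ (q u) (suc c) 1)
                                    ≡⟨ +-interchange₃ (A.credit u) (A.received u) (parity * δ (p u) (suc c) 1)
                                                      (B.credit u) (B.received u) (parity * δ (q u) (suc c) 1) ⟩
    credit₂ u + received₂ u + (parity * δ (p u) (suc c) 1 + parity * δ (q u) (suc c) 1)
                                    ≡⟨ cong (credit₂ u + received₂ u +_) (trans (cong (λ z → parity * (δ (p u) (suc c) 1 + δ z (suc c) 1)) d∸p≡q)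
                                             (*-distribˡ-+ parity _ _)) ⟨
    credit₂ u + received₂ u + X (p u) ∎)
    where
    open ≤-Reasoning
    d∸p≡q : d ∸ p u ≡ q u
    d∸p≡q = trans (cong (_∸ p u) (sym geo)) (m+n∸m≡n (p u) (q u))
    +-comm-middle : ∀ x y z → x + y + z ≡ x + z + y
    +-comm-middle = solve 3 (λ x y z → x :+ y :+ z := x :+ z :+ y) refl
    +-interchange₃ : ∀ x y z x′ y′ z′ → (x + y + z) + (x′ + y′ + z′) ≡ (x + x′) + (y + y′) + (z + z′)
    +-interchange₃ = solve 6 (λ x y z x′ y′ z′ → (x :+ y :+ z) :+ (x′ :+ y′ :+ z′) := (x :+ x′) :+ (y :+ y′) :+ (z :+ z′)) refl

  off-geodesic-middle : ∀ {u} → e u ≤ c → p u + q u ≢ d → p u ≡ c × q u ≡ c × c ≡ suc h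
  off-geodesic-middle {u} eu≤c off = proj₁ pu≡c×qu≡c , proj₂ pu≡c×qu≡c , +-cancelʳ-≡ c c (suc h) c+c≡1+h+c
    where
    pu+qu≤c+c : p u + q u ≤ c + c
    pu+qu≤c+c = +-mono-≤ (≤-trans (A.p≤e u) eu≤c) (≤-trans (A.q≤e u) eu≤c)
    1+d≤pu+qu : suc d ≤ p u + q u
    1+d≤pu+qu = ≤∧≢⇒< (A.d≤p+q u) (≢-sym off)
    c+c≡1+h+c : c + c ≡ suc h + c
    c+c≡1+h+c = trans (≤-antisym c+c≤1+d (≤-trans 1+d≤pu+qu pu+qu≤c+c)) (cong suc d≡h+c)
    pu≡c×qu≡c : p u ≡ c × q u ≡ c
    pu≡c×qu≡c = both≡ (≤-trans (A.p≤e u) eu≤c) (≤-trans (A.q≤e u) eu≤c) (≤-trans c+c≤1+d 1+d≤pu+qu)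

  -- Off the geodesics the two steps towards a and towards b already give K, unless d is odd and u sits
  -- in the middle with small eccentricity; then one of the two steps is a level edge for the other layering.
  off-geodesic : ∀ u → p u + q u ≢ d → K ≤ credit₂ u
  off-geodesic u off with A.toward-a u u≢a | B.toward-a u u≢b
    where
    u≢a : u ≢ a
    u≢a refl = off (trans (cong (_+ q a) A.p-a) A.q-a)
    u≢b : u ≢ b
    u≢b refl = off (trans (cong (p b +_) A.q-b) (trans (+-identityʳ _) A.p-b))
  ... | x , ux , px+1≡pu | y , uy , qy+1≡qu with suc c ≤? e u
  ...   | yes c<eu = ≤-trans (≤-reflexive K≡) (≤-trans (+-mono-≤ (+-mono-≤ c<eu (A.c≤e x)) (+-mono-≤ c<eu (A.c≤e y)))
                                                      (+-mono-≤ (A.e+e≤credit ux px+1≡pu) (B.e+e≤credit uy qy+1≡qu)))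
  ...   | no  c≮eu with off-geodesic-middle (≮⇒≥ c≮eu) off
  ...     | pu≡c , qu≡c , odd with suc c ≤? e x | suc c ≤? e y
  ...       | no c≮ex | _ = ≤-trans K≤c+c+[c+c+c]
                              (+-mono-≤ (≤-trans (+-mono-≤ (A.c≤e u) (A.c≤e x)) (A.e+e≤credit ux px+1≡pu))
                                        (≤-trans (+-mono-≤ (+-mono-≤ (A.c≤e u) (A.c≤e y)) (A.c≤e u))
                                                 (B.credit-two-neighbours ux qx≡qu uy qy+1≡qu)))
    where
    qx≡qu : q x ≡ q u
    qx≡qu = trans (proj₁ (A.pin-q (suc-injective (trans px+1≡pu (trans pu≡c odd))) (sym d≡h+c) (≤-trans (A.q≤e x) (≮⇒≥ c≮ex))))
                  (sym qu≡c)
  ...       | yes c<ex | no c≮ey = ≤-trans K≤c+c+[c+c+c]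
                              (subst ((c + c) + (c + c + c) ≤_) (+-comm (B.credit u) (A.credit u))
                                (+-mono-≤ (≤-trans (+-mono-≤ (A.c≤e u) (A.c≤e y)) (B.e+e≤credit uy qy+1≡qu))
                                          (≤-trans (+-mono-≤ (+-mono-≤ (A.c≤e u) (A.c≤e x)) (A.c≤e u))
                                                   (A.credit-two-neighbours uy py≡pu ux px+1≡pu))))
    where
    py≡pu : p y ≡ p u
    py≡pu = trans (proj₁ (A.pin-p (suc-injective (trans qy+1≡qu (trans qu≡c odd))) (trans (+-comm c h) (sym d≡h+c)) (≤-trans (A.p≤e y) (≮⇒≥ c≮ey))))
                  (sym pu≡c)
  ...       | yes c<ex | yes c<ey = +-mono-≤ (≤-trans (+-mono-≤ (A.c≤e u) c<ex) (A.e+e≤credit ux px+1≡pu))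
                                         (≤-trans (+-mono-≤ (A.c≤e u) c<ey) (B.e+e≤credit uy qy+1≡qu))

  charge-bound : ∀ u → charge u + paid₂ u ≤ credit₂ u + received₂ u
  charge-bound u with p u + q u ≟ℕ d
  ... | yes geo = charge-geodesic u geo
  ... | no  off = begin
    charge u + paid₂ u       ≡⟨ cong₂ _+_ (if≡ᵇ-≢ off) (cong₂ _+_ (A.paid-off off) (B.paid-off (λ e → off (trans (+-comm (p u) (q u)) e)))) ⟩
    K + 0                    ≡⟨ +-identityʳ K ⟩
    K                        ≤⟨ off-geodesic u off ⟩
    credit₂ u                ≤⟨ m≤m+n _ _ ⟩
    credit₂ u + received₂ u  ∎
    where open ≤-Reasoning

  ∑credit₂ : ∑ credit₂ ≡ ξc G + ξc G
  ∑credit₂ = trans (∑-distrib-+ A.credit B.credit)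
                   (cong₂ _+_ (∑∑-W p (λ u v → dist-adj u v a)) (∑∑-W q (λ u v → dist-adj u v b)))

  ∑paid₂≡∑received₂ : ∑ paid₂ ≡ ∑ received₂
  ∑paid₂≡∑received₂ = begin
    ∑ paid₂                       ≡⟨ ∑-distrib-+ A.paid B.paid ⟩
    ∑ A.paid + ∑ B.paid           ≡⟨ cong₂ _+_ (∑∑-edge-swap A.transfer) (∑∑-edge-swap B.transfer) ⟩
    ∑ A.received + ∑ B.received   ≡⟨ ∑-distrib-+ A.received B.received ⟨
    ∑ received₂                   ∎
    where open ≡-Reasoning

  ∑charge≤ξc+ξc : ∑ charge ≤ ξc G + ξc G
  ∑charge≤ξc+ξc = +-cancelʳ-≤ (∑ paid₂) _ _ (begin
    ∑ charge + ∑ paid₂                 ≡⟨ ∑-distrib-+ charge paid₂ ⟨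
    ∑ (λ u → charge u + paid₂ u)       ≤⟨ ∑-mono-≤ charge-bound ⟩
    ∑ (λ u → credit₂ u + received₂ u) ≡⟨ ∑-distrib-+ credit₂ received₂ ⟩
    ∑ credit₂ + ∑ received₂            ≡⟨ cong₂ _+_ ∑credit₂ (sym ∑paid₂≡∑received₂) ⟩
    ξc G + ξc G + ∑ paid₂              ∎)
    where open ≤-Reasoning

  bonus : Fin n → Fin n → ℕ
  bonus x u = if does (u ≟ x) then K else 0

  ∑bonus : ∀ x → ∑ (bonus x) ≡ K
  ∑bonus x = trans (∑-single (bonus x) x vanish) (cong (λ z → if z then K else 0) (≟-refl x))
    where
    vanish : ∀ y → y ≢ x → bonus x y ≡ 0
    vanish y y≢x with y ≟ x
    ... | yes y≡x = ⊥-elim (y≢x y≡x)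
    ... | no  _   = refl

  ρ′ excess : ℕ → ℕ
  ρ′ j     = ρ j + δ j 0 K + δ j d K
  excess j = ρ′ j ∸ K

  K≤ρ′ : ∀ j → j ≤ d → K ≤ ρ′ j
  K≤ρ′ zero    _ = ≤-trans (m≤n+m K (ρ 0)) (m≤m+n _ _)
  K≤ρ′ (suc j) 1+j≤d with m≤n⇒m<n∨m≡n 1+j≤d
  ... | inj₁ 1+j<d = ≤-trans (K≤ρ (suc j) (s≤s z≤n) 1+j<d) (≤-trans (m≤m+n _ _) (m≤m+n _ _))
  ... | inj₂ 1+j≡d = ≤-trans (≤-reflexive (sym (δ-≡ K 1+j≡d))) (m≤n+m _ _)

  bonus-a : ∀ u → bonus a u ≡ δ (p u) 0 K
  bonus-a u with u ≟ a
  ... | yes refl = sym (δ-≡ K A.p-a)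
  ... | no  u≢a  = sym (δ-≢ K (λ pu≡0 → u≢a (dist-zero⁻ u a pu≡0)))

  bonus-b : ∀ u → p u + q u ≡ d → bonus b u ≡ δ (p u) d K
  bonus-b u geo with u ≟ b
  ... | yes refl = sym (δ-≡ K A.p-b)
  ... | no  u≢b  = sym (δ-≢ K (λ pu≡d → u≢b (dist-zero⁻ u b (+-cancelˡ-≡ (p u) (q u) 0
                                                                (trans geo (trans (sym pu≡d) (sym (+-identityʳ _))))))))

  charge-layered : ∀ u → K + ∑ℕ (suc d) (λ j → A.onLayer j u * excess j) ≤ charge u + bonus a u + bonus b u
  charge-layered u with p u + q u ≟ℕ d
  ... | yes geo = ≤-reflexive (begin
    K + ∑ℕ (suc d) (λ j → A.onLayer j u * excess j)   ≡⟨ cong (K +_) (A.∑ℕ-onLayer geo excess) ⟩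
    K + excess (p u)                                  ≡⟨ m+[n∸m]≡n (K≤ρ′ (p u) (≤-trans (m≤m+n (p u) (q u)) (≤-reflexive geo))) ⟩
    ρ (p u) + δ (p u) 0 K + δ (p u) d K               ≡⟨ cong₂ (λ x y → x + y + δ (p u) d K) (if≡ᵇ-≡ geo) (bonus-a u) ⟨
    charge u + bonus a u + δ (p u) d K                ≡⟨ cong (charge u + bonus a u +_) (bonus-b u geo) ⟨
    charge u + bonus a u + bonus b u                  ∎)
    where open ≡-Reasoning
  ... | no  off = begin
    K + ∑ℕ (suc d) (λ j → A.onLayer j u * excess j)   ≡⟨ trans (cong (K +_) (A.∑ℕ-onLayer-off off excess)) (+-identityʳ K) ⟩
    K                                                 ≡⟨ if≡ᵇ-≢ off ⟨
    charge u                                          ≤⟨ ≤-trans (m≤m+n _ _) (m≤m+n _ _) ⟩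
    charge u + bonus a u + bonus b u                  ∎
    where open ≤-Reasoning

  n*K+∑excess≤ : n * K + ∑ℕ (suc d) excess ≤ ∑ charge + K + K
  n*K+∑excess≤ = begin
    n * K + ∑ℕ (suc d) excess
      ≤⟨ +-monoʳ-≤ (n * K) (A.∑ℕ≤∑-layers excess) ⟩
    n * K + ∑ (λ u → ∑ℕ (suc d) (λ j → A.onLayer j u * excess j))
      ≡⟨ cong (_+ ∑ (λ u → ∑ℕ (suc d) (λ j → A.onLayer j u * excess j))) (∑-const {n} K) ⟨
    ∑ {n} (λ _ → K) + ∑ (λ u → ∑ℕ (suc d) (λ j → A.onLayer j u * excess j))
      ≡⟨ ∑-distrib-+ {n} (λ _ → K) _ ⟨
    ∑ (λ u → K + ∑ℕ (suc d) (λ j → A.onLayer j u * excess j))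
      ≤⟨ ∑-mono-≤ charge-layered ⟩
    ∑ (λ u → charge u + bonus a u + bonus b u)
      ≡⟨ trans (∑-distrib-+ (λ u → charge u + bonus a u) (bonus b)) (cong₂ _+_ (∑-distrib-+ charge (bonus a)) (∑bonus b)) ⟩
    ∑ charge + ∑ (bonus a) + K
      ≡⟨ cong (λ z → ∑ charge + z + K) (∑bonus a) ⟩
    ∑ charge + K + K ∎
    where open ≤-Reasoning

  ∑excess : ∑ℕ (suc d) excess + suc d * K ≡ ∑ℕ (suc d) ρ + K + K
  ∑excess = begin
    ∑ℕ (suc d) excess + suc d * K                  ≡⟨ cong (∑ℕ (suc d) excess +_) (∑ℕ-const (suc d) K) ⟨
    ∑ℕ (suc d) excess + ∑ℕ (suc d) (λ _ → K)       ≡⟨ ∑ℕ-distrib-+ (suc d) excess (λ _ → K) ⟨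
    ∑ℕ (suc d) (λ j → excess j + K)                ≡⟨ ∑ℕ-cong (suc d) (λ j j<1+d → m∸n+n≡m (K≤ρ′ j (s≤s⁻¹ j<1+d))) ⟩
    ∑ℕ (suc d) ρ′                                  ≡⟨ trans (∑ℕ-distrib-+ (suc d) (λ j → ρ j + δ j 0 K) (λ j → δ j d K))
                                                           (cong (_+ ∑ℕ (suc d) (λ j → δ j d K)) (∑ℕ-distrib-+ (suc d) ρ (λ j → δ j 0 K))) ⟩
    ∑ℕ (suc d) ρ + ∑ℕ (suc d) (λ j → δ j 0 K) + ∑ℕ (suc d) (λ j → δ j d K)
                                                   ≡⟨ cong₂ (λ x y → ∑ℕ (suc d) ρ + x + y) (∑ℕ-δ′ (suc d) 0 (λ _ → K) (s≤s z≤n))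
                                                                                            (∑ℕ-δ′ (suc d) d (λ _ → K) ≤-refl) ⟩
    ∑ℕ (suc d) ρ + K + K                           ∎
    where open ≡-Reasoning

  ∑R≤∑ρ : ∑ℕ (suc d) R ≤ ∑ℕ (suc d) ρ
  ∑R≤∑ρ = +-cancelʳ-≤ (∑ℕ (suc d) Y) _ _ (≤-reflexive (begin
    ∑ℕ (suc d) R + ∑ℕ (suc d) Y         ≡⟨ ∑ℕ-distrib-+ (suc d) R Y ⟨
    ∑ℕ (suc d) (λ i → R i + Y i)        ≡⟨ ∑ℕ-cong (suc d) (λ i _ → ρ+X≡R+Y i) ⟨
    ∑ℕ (suc d) (λ i → ρ i + X i)        ≡⟨ ∑ℕ-distrib-+ (suc d) ρ X ⟩
    ∑ℕ (suc d) ρ + ∑ℕ (suc d) X         ≡⟨ cong (∑ℕ (suc d) ρ +_) ∑X≡∑Y ⟩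
    ∑ℕ (suc d) ρ + ∑ℕ (suc d) Y         ∎))
    where open ≡-Reasoning

  lower-bound : n * K + ∑ℕ (suc d) R ≤ ξc G + ξc G + suc d * K
  lower-bound = +-cancelʳ-≤ (K + K) _ _ (begin
    n * K + ∑ℕ (suc d) R + (K + K)                 ≤⟨ +-monoˡ-≤ (K + K) (+-monoʳ-≤ (n * K) ∑R≤∑ρ) ⟩
    n * K + ∑ℕ (suc d) ρ + (K + K)                 ≡⟨ regroup (n * K) (∑ℕ (suc d) ρ) K ⟩
    n * K + (∑ℕ (suc d) ρ + K + K)                 ≡⟨ cong (n * K +_) ∑excess ⟨
    n * K + (∑ℕ (suc d) excess + suc d * K)        ≡⟨ +-assoc (n * K) _ _ ⟨
    n * K + ∑ℕ (suc d) excess + suc d * K          ≤⟨ +-monoˡ-≤ (suc d * K) n*K+∑excess≤ ⟩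
    ∑ charge + K + K + suc d * K                   ≤⟨ +-monoˡ-≤ (suc d * K) (+-monoˡ-≤ K (+-monoˡ-≤ K ∑charge≤ξc+ξc)) ⟩
    ξc G + ξc G + K + K + suc d * K                ≡⟨ regroup′ (ξc G + ξc G) K (suc d * K) ⟩
    ξc G + ξc G + suc d * K + (K + K)              ∎)
    where
    open ≤-Reasoning
    regroup : ∀ x y k → x + y + (k + k) ≡ x + (y + k + k)
    regroup = solve 3 (λ x y k → x :+ y :+ (k :+ k) := x :+ (y :+ k :+ k)) refl
    regroup′ : ∀ x k s → x + k + k + s ≡ x + s + (k + k)
    regroup′ = solve 3 (λ x k s → x :+ k :+ k :+ s := x :+ s :+ (k :+ k)) refl

  1+d≤n : suc d ≤ n
  1+d≤n = begin
    suc d                                                  ≡⟨ trans (sym (*-identityʳ (suc d))) (sym (∑ℕ-const (suc d) 1)) ⟩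
    ∑ℕ (suc d) (λ _ → 1)                                   ≤⟨ A.∑ℕ≤∑-layers (λ _ → 1) ⟩
    ∑ (λ u → ∑ℕ (suc d) (λ j → A.onLayer j u * 1))         ≤⟨ ∑-mono-≤ (λ u → A.∑ℕ-onLayer≤ u (λ _ → 1)) ⟩
    ∑ {n} (λ _ → 1)                                        ≡⟨ trans (∑-const {n} 1) (*-identityʳ n) ⟩
    n                                                      ∎
    where open ≤-Reasoning

-- The upper bound for the volcano graph

≡ᵇ-true⁻ : ∀ {x y} → (x ≡ᵇ y) ≡ true → x ≡ y
≡ᵇ-true⁻ {x} {y} e = ≡ᵇ⇒≡ x y (subst T (sym e) _)

≤ᵇ-true⁻ : ∀ {x y} → (x ≤ᵇ y) ≡ true → x ≤ y
≤ᵇ-true⁻ {x} {y} e = ≤ᵇ⇒≤ x y (subst T (sym e) _)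

<ᵇ-true⁻ : ∀ {x y} → (x <ᵇ y) ≡ true → x < y
<ᵇ-true⁻ {x} {y} e = <ᵇ⇒< x y (subst T (sym e) _)

T⇒≡true : ∀ {x} → T x → x ≡ true
T⇒≡true {true} _ = refl

<ᵇ-false : ∀ {x y} → y ≤ x → (x <ᵇ y) ≡ false
<ᵇ-false {x} {y} y≤x with x <ᵇ y in x<ᵇy
... | true  = ⊥-elim (<⇒≱ (<ᵇ-true⁻ x<ᵇy) y≤x)
... | false = refl

module VolcanoBound (n d : ℕ) (3≤d : 3 ≤ d) (1+d≤n : suc d ≤ n) where

  open Profile d 3≤d

  V : Graph n
  V = volcano n d

  open EdgeSums V

  data VolcanoEdge (u v : Fin n) : Set where
    path-up   : toℕ v ≡ suc (toℕ u) → toℕ v ≤ d → VolcanoEdge u v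
    path-down : toℕ u ≡ suc (toℕ v) → toℕ u ≤ d → VolcanoEdge u v
    leaf-hub  : d < toℕ u → toℕ v ≡ h → VolcanoEdge u v
    hub-leaf  : d < toℕ v → toℕ u ≡ h → VolcanoEdge u v

  rel⁻ : ∀ u v → Graph.rel V u v ≡ true → (toℕ v ≡ suc (toℕ u) × toℕ v ≤ d) ⊎ (d < toℕ u × toℕ v ≡ h)
  rel⁻ u v r with ∨-elim ((suc (toℕ u) ≡ᵇ toℕ v) ∧ (toℕ v ≤ᵇ d)) r
  ... | inj₁ step with ∧-elim (suc (toℕ u) ≡ᵇ toℕ v) step
  ...   | is-suc , ≤d = inj₁ (sym (≡ᵇ-true⁻ is-suc) , ≤ᵇ-true⁻ ≤d)
  rel⁻ u v r | inj₂ leaf with ∧-elim (d <ᵇ toℕ u) leaf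
  ...   | >d , is-h = inj₂ (<ᵇ-true⁻ >d , ≡ᵇ-true⁻ is-h)

  Adj⁻ : ∀ {u v} → Adj V u v → VolcanoEdge u v
  Adj⁻ {u} {v} uv with ∨-elim (Graph.rel V u v) (proj₁ (∧-elim (Graph.rel V u v ∨ Graph.rel V v u) uv))
  ... | inj₁ r with rel⁻ u v r
  ...   | inj₁ (v≡1+u , v≤d) = path-up v≡1+u v≤d
  ...   | inj₂ (d<u , v≡h)   = leaf-hub d<u v≡h
  Adj⁻ {u} {v} uv | inj₂ r with rel⁻ v u r
  ...   | inj₁ (u≡1+v , u≤d) = path-down u≡1+v u≤d
  ...   | inj₂ (d<v , u≡h)   = hub-leaf d<v u≡h

  Adj-intro : ∀ {u v} → Graph.rel V u v ≡ true → u ≢ v → Adj V u v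
  Adj-intro {u} {v} r u≢v = ∧-intro (∨-introˡ _ r) (not-does u≢v)
    where
    not-does : u ≢ v → not (does (u ≟ v)) ≡ true
    not-does u≢v with u ≟ v
    ... | yes u≡v = ⊥-elim (u≢v u≡v)
    ... | no  _   = refl

  Adj-path : ∀ {u v} → toℕ v ≡ suc (toℕ u) → toℕ v ≤ d → Adj V u v
  Adj-path {u} {v} v≡1+u v≤d =
    Adj-intro {u} {v} (∨-introˡ _ (∧-intro (T⇒≡true (≡⇒≡ᵇ _ _ (sym v≡1+u))) (T⇒≡true (≤⇒≤ᵇ v≤d))))
              (λ { refl → 1+n≢n (sym v≡1+u) })

  Adj-leaf : ∀ {u v} → d < toℕ u → toℕ v ≡ h → Adj V u v
  Adj-leaf {u} {v} d<u v≡h =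
    Adj-intro {u} {v} (∨-introʳ ((suc (toℕ u) ≡ᵇ toℕ v) ∧ (toℕ v ≤ᵇ d)) (∧-intro (T⇒≡true (<⇒<ᵇ d<u)) (T⇒≡true (≡⇒≡ᵇ _ _ v≡h))))
              (λ { refl → <⇒≱ d<u (≤-trans (≤-reflexive v≡h) h≤d) })

  reach-path : ∀ k {u v} → toℕ u + k ≡ toℕ v → toℕ v ≤ d → reach V k u v ≡ true
  reach-path zero    {u} {v} u+0≡v _ =
    subst (λ w → reach V 0 w v ≡ true) (toℕ-injective (trans (sym u+0≡v) (+-identityʳ _)) ) (reach-refl V 0 v)
  reach-path (suc k) {u} {v} u+1+k≡v v≤d =
    reach-step V k u w v (Adj-path w≡1+u (≤-trans (≤-reflexive w≡1+u) (≤-trans 1+u≤v v≤d)))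
               (reach-path k (trans (cong (_+ k) w≡1+u) (trans (sym (+-suc (toℕ u) k)) u+1+k≡v)) v≤d)
    where
    1+u≤v : suc (toℕ u) ≤ toℕ v
    1+u≤v = subst (suc (toℕ u) ≤_) (trans (sym (+-suc (toℕ u) k)) u+1+k≡v) (s≤s (m≤m+n (toℕ u) k))
    1+u<n : suc (toℕ u) < n
    1+u<n = ≤-trans (s≤s 1+u≤v) (toℕ<n v)
    w : Fin n
    w = fromℕ< 1+u<n
    w≡1+u : toℕ w ≡ suc (toℕ u)
    w≡1+u = toℕ-fromℕ< 1+u<n

  reach-along-path : ∀ {u v} → toℕ u ≤ d → toℕ v ≤ d → reach V ∣ toℕ u - toℕ v ∣ u v ≡ true
  reach-along-path {u} {v} u≤d v≤d with ≤-total (toℕ u) (toℕ v)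
  ... | inj₁ u≤v = subst (λ k → reach V k u v ≡ true) (sym (m≤n⇒∣m-n∣≡n∸m u≤v))
                         (reach-path (toℕ v ∸ toℕ u) (m+[n∸m]≡n u≤v) v≤d)
  ... | inj₂ v≤u = subst (λ k → reach V k u v ≡ true) (sym (m≤n⇒∣n-m∣≡n∸m v≤u))
                         (reach-sym V (toℕ u ∸ toℕ v) v u (reach-path (toℕ u ∸ toℕ v) (m+[n∸m]≡n v≤u) u≤d))

  h<n : h < n
  h<n = ≤-trans (s≤s h≤d) 1+d≤n

  hub : Fin n
  hub = fromℕ< h<n

  hub≡h : toℕ hub ≡ h
  hub≡h = toℕ-fromℕ< h<n

  hub≤d : toℕ hub ≤ d
  hub≤d = ≤-trans (≤-reflexive hub≡h) h≤d

  reach-hub : ∀ {w} → d < toℕ w → reach V 1 w hub ≡ true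
  reach-hub {w} d<w = reach-step V 0 w hub hub (Adj-leaf d<w hub≡h) (reach-refl V 0 hub)

  ecc-path : ∀ {u} → toℕ u ≤ d → ecc V u ≤ m (toℕ u)
  ecc-path {u} u≤d = ecc≤ V u bound
    where
    bound : ∀ w → dist V w u ≤ m (toℕ u)
    bound w with toℕ w ≤? d
    ... | yes w≤d = ≤-trans (dist-minimal V ∣ toℕ w - toℕ u ∣ w u (reach-along-path w≤d u≤d)) (∣j-i∣≤m w≤d)
    ... | no  w≰d = ≤-trans (dist-minimal V _ w u (reach-trans V 1 ∣ toℕ hub - toℕ u ∣ w hub u (reach-hub (≰⇒> w≰d)) (reach-along-path hub≤d u≤d)))
                            (subst (λ k → suc ∣ k - toℕ u ∣ ≤ m (toℕ u)) (sym hub≡h) (1+∣h-i∣≤m u≤d))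

  ecc-leaf : ∀ {u} → d < toℕ u → ecc V u ≤ suc c
  ecc-leaf {u} d<u = ecc≤ V u bound
    where
    hub-u : reach V 1 hub u ≡ true
    hub-u = reach-sym V 1 u hub (reach-hub d<u)
    bound : ∀ w → dist V w u ≤ suc c
    bound w with toℕ w ≤? d
    ... | yes w≤d = ≤-trans (dist-minimal V _ w u (reach-trans V ∣ toℕ w - toℕ hub ∣ 1 w hub u (reach-along-path w≤d hub≤d) hub-u))
                            (≤-trans (≤-reflexive (+-comm _ 1))
                                     (s≤s (subst (λ k → ∣ toℕ w - k ∣ ≤ c) (sym hub≡h) (subst (∣ toℕ w - h ∣ ≤_) m-h≡c (∣j-i∣≤m w≤d)))))
    ... | no  w≰d = ≤-trans (dist-minimal V 2 w u (reach-trans V 1 1 w hub u (reach-hub (≰⇒> w≰d)) hub-u))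
                            (s≤s (≤-trans (s≤s z≤n) 2≤c))

  r : ℕ
  r = n ∸ suc d

  n≡1+d+r : n ≡ suc d + r
  n≡1+d+r = sym (m+[n∸m]≡n 1+d≤n)

  ∑ℕ-after-path : ∀ (f : ℕ → ℕ) {x} → (∀ i → i ≤ d → f i ≡ 0) → (∀ j → f (suc d + j) ≡ x) → ∑ℕ n f ≡ r * x
  ∑ℕ-after-path f {x} on-path off-path = begin
    ∑ℕ n f                                              ≡⟨ cong (λ k → ∑ℕ k f) n≡1+d+r ⟩
    ∑ℕ (suc d + r) f                                    ≡⟨ ∑ℕ-split (suc d) r f ⟩
    ∑ℕ (suc d) f + ∑ℕ r (λ j → f (suc d + j))           ≡⟨ cong₂ _+_ (trans (∑ℕ-cong (suc d) (λ i i<1+d → on-path i (s≤s⁻¹ i<1+d))) (∑ℕ-zero (suc d)))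
                                                                      (trans (∑ℕ-cong r (λ j _ → off-path j)) (∑ℕ-const r x)) ⟩
    r * x                                               ∎
    where open ≡-Reasoning

  leaves : ℕ → ℕ → ℕ
  leaves x j = if d <ᵇ j then x else 0

  ∑ℕ-leaves : ∀ x → ∑ℕ n (leaves x) ≡ r * x
  ∑ℕ-leaves x = ∑ℕ-after-path (leaves x) (λ i i≤d → cong (λ z → if z then x else 0) (<ᵇ-false i≤d))
                                         (λ j → cong (λ z → if z then x else 0) (T⇒≡true (<⇒<ᵇ (s≤s (m≤m+n d j)))))

  L-up : ∀ {i} → i < d → m i + m (suc i) ≡ L (d ∸ i)
  L-up {i} i<d = sym (trans (cong L (+-∸-assoc 1 i<d))
                            (cong₂ _+_ (trans (cong m (sym (+-∸-assoc 1 i<d))) (m-mirror (<⇒≤ i<d))) (m-mirror i<d)))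

  path-term : ℕ → ℕ → ℕ
  path-term i j = δ (suc i) j (L (d ∸ i)) + δ (suc j) i (L i) + δ i h (leaves Kh j)

  edge≤path-term : ∀ {u} v → toℕ u ≤ d → edge u v * (ecc V u + ecc V v) ≤ path-term (toℕ u) (toℕ v)
  edge≤path-term {u} v u≤d with adj V u v in uv
  ... | false = z≤n
  ... | true with Adj⁻ uv
  ...   | path-up v≡1+u v≤d = ≤-trans (≤-reflexive (+-identityʳ _)) (≤-trans (+-mono-≤ (ecc-path u≤d) (ecc-path v≤d))
            (≤-trans (≤-reflexive (trans (cong (λ k → m (toℕ u) + m k) v≡1+u) (trans (L-up u<d) (sym (δ-≡ _ (sym v≡1+u))))))
                     (≤-trans (m≤m+n _ _) (m≤m+n _ _))))
    where
    u<d : toℕ u < d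
    u<d = ≤-trans (≤-reflexive (sym v≡1+u)) v≤d
  ...   | path-down u≡1+v _ = ≤-trans (≤-reflexive (+-identityʳ _)) (≤-trans (+-mono-≤ (ecc-path u≤d) (ecc-path v≤d))
            (≤-trans (≤-reflexive (trans (cong (λ k → m k + m (toℕ v)) u≡1+v) (trans (cong L (sym u≡1+v)) (sym (δ-≡ _ (sym u≡1+v))))))
                     (≤-trans (m≤n+m _ (δ (suc (toℕ u)) (toℕ v) (L (d ∸ toℕ u)))) (m≤m+n _ (δ (toℕ u) h (leaves Kh (toℕ v)))))))
    where
    v≤d : toℕ v ≤ d
    v≤d = ≤-trans (n≤1+n _) (≤-trans (≤-reflexive (sym u≡1+v)) u≤d)
  ...   | leaf-hub d<u _ = ⊥-elim (<⇒≱ d<u u≤d)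
  ...   | hub-leaf d<v u≡h = ≤-trans (≤-reflexive (+-identityʳ _)) (≤-trans (+-mono-≤ (ecc-path u≤d) (ecc-leaf d<v))
            (≤-trans (≤-reflexive (trans (cong (λ k → m k + suc c) u≡h) (trans (cong (_+ suc c) m-h≡c)
                                         (sym (trans (δ-≡ _ u≡h) (cong (λ z → if z then Kh else 0) (T⇒≡true (<⇒<ᵇ d<v)))))))) 
                     (m≤n+m _ _)))

  edge≤leaf-term : ∀ {u} v → d < toℕ u → edge u v * (ecc V u + ecc V v) ≤ δ (toℕ v) h Kh
  edge≤leaf-term {u} v d<u with adj V u v in uv
  ... | false = z≤n
  ... | true with Adj⁻ uv
  ...   | path-up v≡1+u v≤d = ⊥-elim (<⇒≱ (≤-trans d<u (n≤1+n _)) (≤-trans (≤-reflexive (sym v≡1+u)) v≤d))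
  ...   | path-down _ u≤d   = ⊥-elim (<⇒≱ d<u u≤d)
  ...   | hub-leaf _ u≡h    = ⊥-elim (<⇒≱ d<u (≤-trans (≤-reflexive u≡h) h≤d))
  ...   | leaf-hub _ v≡h    = ≤-trans (≤-reflexive (+-identityʳ _))
            (≤-trans (+-mono-≤ (ecc-leaf d<u) (ecc-path (≤-trans (≤-reflexive v≡h) h≤d)))
                     (≤-reflexive (trans (cong (λ k → suc c + m k) v≡h) (trans (cong (suc c +_) m-h≡c)
                                         (trans (+-comm (suc c) c) (sym (δ-≡ Kh v≡h)))))))

  row : Fin n → ℕ
  row u = ∑ (λ v → edge u v * (ecc V u + ecc V v))

  row-path : ∀ {u} → toℕ u ≤ d → row u ≤ R (toℕ u) + δ (toℕ u) h (r * Kh)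
  row-path {u} u≤d = let i = toℕ u in begin
    row u                                               ≤⟨ ∑-mono-≤ {n} (λ v → edge≤path-term v u≤d) ⟩
    ∑ {n} (λ v → path-term i (toℕ v))                   ≡⟨ ∑-toℕ {n} (path-term i) ⟩
    ∑ℕ n (path-term i)                                  ≡⟨ trans (∑ℕ-distrib-+ n (λ j → δ (suc i) j (L (d ∸ i)) + δ (suc j) i (L i)) (λ j → δ i h (leaves Kh j)))
                                                                 (cong (_+ ∑ℕ n (λ j → δ i h (leaves Kh j)))
                                                                       (∑ℕ-distrib-+ n (λ j → δ (suc i) j (L (d ∸ i))) (λ j → δ (suc j) i (L i)))) ⟩
    ∑ℕ n (λ j → δ (suc i) j (L (d ∸ i))) + ∑ℕ n (λ j → δ (suc j) i (L i)) + ∑ℕ n (λ j → δ i h (leaves Kh j))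
                                                        ≤⟨ +-mono-≤ (+-mono-≤ (∑ℕ-δ≤ n (suc i) (λ _ → L (d ∸ i))) (∑ℕ-δ-pred≤ n i (L i)))
                                                                    (≤-reflexive (trans (∑ℕ-δ-outside n i h (leaves Kh)) (cong (δ i h) (∑ℕ-leaves Kh)))) ⟩
    L (d ∸ i) + L i + δ i h (r * Kh)                    ≡⟨ cong (_+ δ i h (r * Kh)) (+-comm (L (d ∸ i)) (L i)) ⟩
    R i + δ i h (r * Kh)                                ∎
    where open ≤-Reasoning

  row-leaf : ∀ {u} → d < toℕ u → row u ≤ Kh
  row-leaf {u} d<u = begin
    row u                           ≤⟨ ∑-mono-≤ {n} (λ v → edge≤leaf-term v d<u) ⟩
    ∑ {n} (λ v → δ (toℕ v) h Kh)    ≡⟨ ∑-toℕ {n} (λ j → δ j h Kh) ⟩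
    ∑ℕ n (λ j → δ j h Kh)           ≤⟨ ∑ℕ-δ≤′ n h (λ _ → Kh) ⟩
    Kh                              ∎
    where open ≤-Reasoning

  row-bound : ℕ → ℕ
  row-bound i = if d <ᵇ i then Kh else R i + δ i h (r * Kh)

  row-bound-path : ∀ {i} → i ≤ d → row-bound i ≡ R i + δ i h (r * Kh)
  row-bound-path {i} i≤d = cong (λ z → if z then Kh else R i + δ i h (r * Kh)) (<ᵇ-false i≤d)

  row-bound-leaf : ∀ {i} → d < i → row-bound i ≡ Kh
  row-bound-leaf {i} d<i = cong (λ z → if z then Kh else R i + δ i h (r * Kh)) (T⇒≡true (<⇒<ᵇ d<i))

  row≤row-bound : ∀ u → row u ≤ row-bound (toℕ u)
  row≤row-bound u with toℕ u ≤? d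
  ... | yes u≤d = subst (row u ≤_) (sym (row-bound-path u≤d)) (row-path u≤d)
  ... | no  u≰d = subst (row u ≤_) (sym (row-bound-leaf (≰⇒> u≰d))) (row-leaf (≰⇒> u≰d))

  ∑ℕ-row-bound : ∑ℕ n row-bound ≡ ∑ℕ (suc d) R + r * Kh + r * Kh
  ∑ℕ-row-bound = begin
    ∑ℕ n row-bound                                              ≡⟨ cong (λ k → ∑ℕ k row-bound) n≡1+d+r ⟩
    ∑ℕ (suc d + r) row-bound                                    ≡⟨ ∑ℕ-split (suc d) r row-bound ⟩
    ∑ℕ (suc d) row-bound + ∑ℕ r (λ j → row-bound (suc d + j))    ≡⟨ cong₂ _+_ (∑ℕ-cong (suc d) on-path) (∑ℕ-cong r off-path) ⟩
    ∑ℕ (suc d) (λ i → R i + δ i h (r * Kh)) + ∑ℕ r (λ _ → Kh)    ≡⟨ cong₂ _+_ (trans (∑ℕ-distrib-+ (suc d) R (λ i → δ i h (r * Kh)))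
                                                                                     (cong (∑ℕ (suc d) R +_) (∑ℕ-δ′ (suc d) h (λ _ → r * Kh) (s≤s h≤d))))
                                                                              (∑ℕ-const r Kh) ⟩
    ∑ℕ (suc d) R + r * Kh + r * Kh                              ∎
    where
    open ≡-Reasoning
    on-path : ∀ i → i < suc d → row-bound i ≡ R i + δ i h (r * Kh)
    on-path i i<1+d = row-bound-path (s≤s⁻¹ i<1+d)
    off-path : ∀ j → j < r → row-bound (suc d + j) ≡ Kh
    off-path j _ = row-bound-leaf (s≤s (m≤m+n d j))

  volcano-bound : ξc V + ξc V + suc d * K ≤ n * K + ∑ℕ (suc d) R
  volcano-bound = begin
    ξc V + ξc V + suc d * K                         ≡⟨ cong (_+ suc d * K) ξc+ξc-∑∑ ⟩
    ∑ row + suc d * K                               ≤⟨ +-monoˡ-≤ (suc d * K) (∑-mono-≤ {n} row≤row-bound) ⟩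
    ∑ {n} (λ u → row-bound (toℕ u)) + suc d * K     ≡⟨ cong (_+ suc d * K) (trans (∑-toℕ {n} row-bound) ∑ℕ-row-bound) ⟩
    ∑ℕ (suc d) R + r * Kh + r * Kh + suc d * K      ≡⟨ regroup (∑ℕ (suc d) R) r Kh (suc d) ⟩
    (suc d + r) * K + ∑ℕ (suc d) R                  ≡⟨ cong (λ k → k * K + ∑ℕ (suc d) R) n≡1+d+r ⟨
    n * K + ∑ℕ (suc d) R                            ∎
    where
    open ≤-Reasoning
    regroup : ∀ s r k t → s + r * k + r * k + t * (k + k) ≡ (t + r) * (k + k) + s
    regroup = solve 4 (λ s r k t → s :+ r :* k :+ r :* k :+ t :* (k :+ k) := (t :+ r) :* (k :+ k) :+ s) refl

m+m≤n+n⇒m≤n : ∀ {x y} → x + x ≤ y + y → x ≤ y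
m+m≤n+n⇒m≤n {x} {y} x+x≤y+y with x ≤? y
... | yes x≤y = x≤y
... | no  x≰y = ⊥-elim (<⇒≱ (+-mono-< (≰⇒> x≰y) (≰⇒> x≰y)) x+x≤y+y)

theorem1 : (n d : ℕ) (G : Graph n) → Connected G → diameter G ≡ d → 3 ≤ d →
    ((T : Graph n) → IsSpanningTree G T → IsCaterpillar T × diameter T ≡ d) →
    ξc (volcano n d) ≤ ξc G
theorem1 n d G conn diam≡d 3≤d _ with diametral-pair G diam≡d (≤-trans (s≤s z≤n) 3≤d)
... | a , b , dist-ab≡d = m+m≤n+n⇒m≤n (+-cancelʳ-≤ (suc d * K) _ _
        (≤-trans (VolcanoBound.volcano-bound n d 3≤d 1+d≤n) lower-bound))
  where
  open Profile d 3≤d using (K)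
  open LowerBound G conn d 3≤d a b dist-ab≡d using (lower-bound; 1+d≤n)
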